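{- In a PX instance, an exchange $(\mathcal{C},f)$ is Pareto optimal if and only if it is maximal, trade-in-free and coalition-free.
   Context: A PX instance consists of a finite directed graph $D=(V,A)$ without loops or parallel arcs, a capacity function $c:A\to\mathbb{R}_{>0}$, and, for each agent $v\in V$, a strict total order $>_v$ (the preference list of $v$) on $\{u:(v,u)\in A\}$; $u_1>_v u_2$ means $v$ prefers $u_1$. A packing is a finite set $\mathcal{C}$ of directed cycles of $D$. For $e\in A$ let $\mathcal{C}_e$ be the set of cycles of $\mathcal{C}$ containing $e$. An exchange function is $f:\mathcal{C}\to\mathbb{R}_{>0}$ with $f(e):=\sum_{C\in\mathcal{C}_e}f(C)\le c(e)$ for all $e\in A$ ($f(e)=0$ if no cycle contains $e$); an exchange is a pair $(\mathcal{C},f)$. If $v$ has preference list $v_1>_v\cdots>_v v_z$, then $(\mathcal{C},f)>_v(\mathcal{C}',f')$ means there is $k$ with $f((v,v_i))=f'((v,v_i))$ for $i<k$ and $f((v,v_k))>f'((v,v_k))$. $(\mathcal{C}',f')$ dominates $(\mathcal{C},f)$ if no agent $v$ has $(\mathcal{C},f)>_v(\mathcal{C}',f')$ and some agent $u$ has $(\mathcal{C}',f')>_u(\mathcal{C},f)$; an exchange is Pareto optimal if no exchange dominates it. For an exchange $(\mathcal{C},f)$ let $A_{\mathcal{C}}=\{e\in A: f(e)>0\}$ and let $D'=(V,A')$ with $A'=\{e\in A: c(e)-f(e)>0\}$. The exchange is (i) maximal if $D'$ is acyclic; (ii) trade-in-free if for every $(v,u)\in A_{\mathcal{C}}$ there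 is no directed path $(v,t,\ldots,u)$ in $D'$ from $v$ to $u$ whose second vertex $t$ satisfies $t>_v u$; (iii) coalition-free if for every $k\ge1$ and every $(v_1,u_1),\ldots,(v_k,u_k)\in A_{\mathcal{C}}$ there are no directed paths $(v_1,t_1,\ldots,u_2),(v_2,t_2,\ldots,u_3),\ldots,(v_k,t_k,\ldots,u_1)$ in $D'$ (the $i$-th from $v_i$ to $u_{i+1}$, indices mod $k$, with second vertex $t_i$) such that $t_i>_{v_i}u_i$ for every $i\in\{1,\ldots,k\}$. -}

module Defs where

open import Level using (Level; _⊔_) renaming (suc to lsuc)
open import Data.Nat using (ℕ)
open import Data.Fin using (Fin) renaming (_≟_ to _≟ᶠ_)
open import Data.Bool using (Bool; true; false; if_then_else_)
open import Data.Maybe using (just)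
open import Data.Product using (Σ; ∃; ∃-syntax; _×_; _,_; proj₁; proj₂)
open import Data.Product.Properties using (≡-dec)
open import Data.Sum using (_⊎_)
open import Data.Empty using (⊥)
open import Data.List using (List; []; _∷_; _++_; zip; foldr; last)
open import Data.List.Relation.Unary.All using (All)
open import Data.List.Relation.Unary.Unique.Propositional using (Unique)
open import Data.List.Membership.Propositional using (_∈_)
import Data.List.Membership.DecPropositional as DecMem
open import Relation.Nullary using (¬_; does)
open import Relation.Binary.Core using (Rel)
open import Relation.Binary.Structures using (IsStrictTotalOrder)
open import Relation.Binary.PropositionalEquality using (_≡_; _≢_)
open import Algebra.Structures using (IsCommutativeRing)
open import Function.Bundles using (_⇔_)

-- Ordered fields (the paper uses ℝ; we work over an arbitrary ordered
-- field, of which ℝ is an instance).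

record OrderedField (c ℓ : Level) : Set (lsuc (c ⊔ ℓ)) where
  infixl 7 _*_
  infixl 6 _+_
  infix 4 _≈_ _<_
  field
    Carrier            : Set c
    _≈_                : Rel Carrier ℓ
    _+_ _*_            : Carrier → Carrier → Carrier
    -_                 : Carrier → Carrier
    0# 1#              : Carrier
    _<_                : Rel Carrier ℓ
    isCommutativeRing  : IsCommutativeRing _≈_ _+_ _*_ -_ 0# 1#
    isStrictTotalOrder : IsStrictTotalOrder _≈_ _<_
    0<1                : 0# < 1#
    +-mono-<           : ∀ {a b} d → a < b → a + d < b + d
    *-pos              : ∀ {a b} → 0# < a → 0# < b → 0# < a * b
    inverse            : ∀ x → ¬ (x ≈ 0#) → ∃[ y ] (x * y ≈ 1#)

  infix 4 _≤_
  _≤_ : Rel Carrier ℓ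
  a ≤ b = a < b ⊎ a ≈ b

rotate : ∀ {a} {A : Set a} → List A → List A
rotate []       = []
rotate (x ∷ xs) = xs ++ (x ∷ [])

cyclicPairs : ∀ {a} {A : Set a} → List A → List (A × A)
cyclicPairs xs = zip xs (rotate xs)

linkPairs : ∀ {a} {A : Set a} → List A → List (A × A)
linkPairs []       = []
linkPairs (x ∷ xs) = zip (x ∷ xs) xs

module _ {n : ℕ} {r : Level} (R : Fin n → Fin n → Set r) where

  IsCycle : List (Fin n) → Set r
  IsCycle xs = (xs ≢ []) × Unique xs × All (λ p → R (proj₁ p) (proj₂ p)) (cyclicPairs xs)

  Acyclic : Set r
  Acyclic = ¬ (Σ (List (Fin n)) IsCycle)

  -- a directed path v = w₀, w₁ = t, …, w_m = u (distinct vertices)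
  -- from v to u whose second vertex is t
  PathVia : Fin n → Fin n → Fin n → Set r
  PathVia v t u = Σ (List (Fin n)) λ ws →
      Unique (v ∷ t ∷ ws)
    × All (λ p → R (proj₁ p) (proj₂ p)) (linkPairs (v ∷ t ∷ ws))
    × last (t ∷ ws) ≡ just u

module _ {c ℓ : Level} (F : OrderedField c ℓ) where
  open OrderedField F

  record PX (n : ℕ) : Set (c ⊔ ℓ) where
    field
      arc      : Fin n → Fin n → Bool
      noLoops  : ∀ v → arc v v ≡ false
      cap      : Fin n → Fin n → Carrier       -- only values on arcs matter
      cap-pos  : ∀ v u → arc v u ≡ true → 0# < cap v u
      -- preference list of v: most preferred first
      pref     : Fin n → List (Fin n)
      pref-uniq : ∀ v → Unique (pref v)
      pref-arcs : ∀ v u → (u ∈ pref v) ⇔ (arc v u ≡ true)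

    Arc : Fin n → Fin n → Set
    Arc v u = arc v u ≡ true

    Prefers : Fin n → Fin n → Fin n → Set
    Prefers v t u = Σ (List (Fin n)) λ xs → Σ (List (Fin n)) λ ys →
      (pref v ≡ xs ++ (t ∷ ys)) × (u ∈ ys)

  module _ {n : ℕ} (I : PX n) where
    open PX I

    _∈?ᵃ_ : Fin n × Fin n → List (Fin n) → Bool
    e ∈?ᵃ C = does (DecMem._∈?_ (≡-dec _≟ᶠ_ _≟ᶠ_) e (cyclicPairs C))

    -- f(e) = Σ_{C ∈ 𝒞_e} f(C), for a packing given as a list of
    -- (cycle , value) pairs
    flowOf : List (List (Fin n) × Carrier) → Fin n → Fin n → Carrier
    flowOf 𝒞 v u = foldr (λ Cw acc → (if (v , u) ∈?ᵃ proj₁ Cw then proj₂ Cw else 0#) + acc) 0# 𝒞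

    record Exchange : Set (c ⊔ ℓ) where
      field
        packing   : List (List (Fin n) × Carrier)
        cycles    : All (λ Cw → IsCycle Arc (proj₁ Cw)) packing
        positive  : All (λ Cw → 0# < proj₂ Cw) packing
        feasible  : ∀ v u → flowOf packing v u ≤ cap v u

      flow : Fin n → Fin n → Carrier
      flow = flowOf packing

    open Exchange

    LexGt : (Fin n → Fin n → Carrier) → (Fin n → Fin n → Carrier) → Fin n → List (Fin n) → Set ℓ
    LexGt fX fY v []       = Data.Empty.Polymorphic.⊥
      where import Data.Empty.Polymorphic
    LexGt fX fY v (u ∷ us) = (fY v u < fX v u) ⊎ ((fX v u ≈ fY v u) × LexGt fX fY v us)

    Better : Exchange → Exchange → Fin n → Set ℓ
    Better X Y v = LexGt (flow X) (flow Y) v (pref v)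

    Dominates : Exchange → Exchange → Set ℓ
    Dominates Y X = (∀ v → ¬ Better X Y v) × ∃[ u ] Better Y X u

    ParetoOptimal : Exchange → Set (c ⊔ ℓ)
    ParetoOptimal X = ¬ (Σ Exchange λ Y → Dominates Y X)

    InSupport : Exchange → Fin n → Fin n → Set ℓ
    InSupport X v u = 0# < flow X v u

    Residual : Exchange → Fin n → Fin n → Set ℓ
    Residual X v u = Arc v u × (flow X v u < cap v u)

    Maximal : Exchange → Set ℓ
    Maximal X = Acyclic (Residual X)

    TradeInFree : Exchange → Set ℓ
    TradeInFree X = ∀ v u → InSupport X v u →
      ∀ t → PathVia (Residual X) v t u → ¬ Prefers v t u

    -- a coalition is a nonempty cyclic list of triples (v_i , u_i , t_i)
    CoalitionFree : Exchange → Set ℓ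
    CoalitionFree X = ∀ (T : List (Fin n × Fin n × Fin n)) → T ≢ [] →
      All (λ x → InSupport X (proj₁ x) (proj₁ (proj₂ x))) T →
      All (λ p → PathVia (Residual X) (proj₁ (proj₁ p)) (proj₂ (proj₂ (proj₁ p))) (proj₁ (proj₂ (proj₂ p))))
          (cyclicPairs T) →
      ¬ All (λ x → Prefers (proj₁ x) (proj₂ (proj₂ x)) (proj₁ (proj₂ x))) T

-- A residual cycle of X, or a coalition, yields an exchange dominating X. For a coalition
-- (v_i , u_i , t_i), take a small ε, lower by ε the first cycle of the packing through each
-- (v_i , u_i), and add ε along the closed walk that, for every i, runs from u_i back around
-- that cycle to v_i, over (v_i , t_i), and along the residual path to u_(i+1). Split into
-- cycles, this moves ε off the arcs (v_i , u_i) onto residual arcs including every (v_i , t_i).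
-- Each arc losing flow is preceded, in the list of its agent, by one gaining flow, so for every
-- agent the first changed arc gains: nobody is worse off and v_1 is better off.
-- Trade-in-freeness is the one-member case of coalition-freeness.
--
-- Conversely, let Y dominate a maximal, coalition-free X. Every agent is steady (X and Y agree
-- along its list) or has a top arc (v , t), the first one where they differ, on which Y gives
-- more. Top arcs are residual in X, so, X being maximal, following them from an agent that is
-- not steady ends at a steady vertex w. By flow conservation at w some agent x gets less from
-- Y than from X on (x , w); then x is not steady and its top t is preferred to w. Iterating,
-- some agent repeats, and the agents visited in between form a coalition.

module Submission where

open import Level using (Level; _⊔_)
open import Data.Nat as ℕ using (ℕ; zero; suc)
import Data.Nat.Properties as ℕ
open import Data.Fin as Fin using (Fin; toℕ)
import Data.Fin.Properties as Fin
open import Data.Bool using (true; false; if_then_else_)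
import Data.Bool.Properties as Bool
open import Data.Product using (Σ; ∃; ∃₂; _×_; _,_; proj₁; proj₂; uncurry)
open import Data.Product.Properties using (≡-dec)
open import Data.Sum as Sum using (_⊎_; inj₁; inj₂)
open import Data.Empty using (⊥; ⊥-elim)
open import Data.Maybe using (just)
open import Data.List using (List; []; _∷_; _++_; _∷ʳ_; [_]; zip; map; length; last; concatMap; lookup; applyUpTo)
open import Data.List.Properties using (++-assoc; ++-identityʳ; ∷-injective; concatMap-map; concatMap-pure)
open import Data.List.Relation.Unary.All as All using (All; []; _∷_)
import Data.List.Relation.Unary.All.Properties as All
open import Data.List.Relation.Unary.Any using (here; there)
open import Data.List.Relation.Unary.AllPairs using ([]; _∷_)
open import Data.List.Relation.Unary.Unique.Propositional using (Unique)
open import Data.List.Relation.Unary.First as First using (First; _∷_)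
import Data.List.Relation.Unary.First.Properties as First
open import Data.List.Membership.Propositional using (_∈_; _∉_)
open import Data.List.Membership.Propositional.Properties using (∈-lookup; ∈-++⁺ˡ; ∈-++⁺ʳ; ∈-map⁻)
import Data.List.Membership.DecPropositional as DecMembership
open import Data.List.Relation.Binary.Permutation.Propositional as ↭
  using (_↭_; ↭-refl; ↭-sym; ↭-prep; ↭-reflexive; ↭⇒↭ₛ; module PermutationReasoning)
open import Data.List.Relation.Binary.Permutation.Propositional.Properties
  using (∷↭∷ʳ; shifts; ++-comm; ++⁺; ++⁺ˡ; ++⁺ʳ)
import Data.List.Relation.Binary.Permutation.Setoid.Properties as PermutationSetoid
open import Relation.Nullary using (¬_; Dec; yes; no; does)
open import Relation.Nullary.Decidable using (_⊎-dec_; toSum)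
open import Relation.Binary.Definitions using (DecidableEquality; tri<; tri≈; tri>)
open import Relation.Binary.Structures using (IsStrictTotalOrder)
open import Relation.Binary.Construct.Closure.ReflexiveTransitive as Star using (Star; ε; _◅_; _◅◅_)
open import Relation.Binary.PropositionalEquality as ≡
  using (_≡_; _≢_; refl; sym; trans; cong; subst; subst₂; module ≡-Reasoning)
open import Function.Base using (_∘_)
open import Function.Bundles using (_⇔_; mk⇔; Equivalence)
open import Algebra.Bundles using (CommutativeRing)
import Algebra.Properties.Ring as RingProperties
import Algebra.Properties.Semiring.Mult as SemiringMult
import Algebra.Properties.Semiring.Sum as SemiringSum
import Relation.Binary.Reasoning.Setoid as SetoidReasoning
open import Defs

module _ {a} {A : Set a} where

  Unique-++⁻ˡ : ∀ xs {ys : List A} → Unique (xs ++ ys) → Unique xs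
  Unique-++⁻ˡ []       _        = []
  Unique-++⁻ˡ (x ∷ xs) (x∉ ∷ u) = All.++⁻ˡ xs x∉ ∷ Unique-++⁻ˡ xs u

  Unique-++⁻ʳ : ∀ xs {ys : List A} → Unique (xs ++ ys) → Unique ys
  Unique-++⁻ʳ []       u       = u
  Unique-++⁻ʳ (x ∷ xs) (_ ∷ u) = Unique-++⁻ʳ xs u

  Unique-resp-↭ : ∀ {xs ys : List A} → xs ↭ ys → Unique xs → Unique ys
  Unique-resp-↭ p = PermutationSetoid.Unique-resp-↭ (≡.setoid A) (↭⇒↭ₛ p)

  Unique-zip⁺ : ∀ {b} {B : Set b} {xs : List A} (ys : List B) → Unique xs → Unique (zip xs ys)
  Unique-zip⁺ {xs = []}     ys       _        = []
  Unique-zip⁺ {xs = x ∷ xs} []       _        = []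
  Unique-zip⁺ {xs = x ∷ xs} (y ∷ ys) (x∉ ∷ u) = first-differs x∉ ys ∷ Unique-zip⁺ ys u
    where
    first-differs : ∀ {xs} → All (x ≢_) xs → ∀ ys → All ((x , y) ≢_) (zip xs ys)
    first-differs []          _        = []
    first-differs (_ ∷ _)     []       = []
    first-differs (x≢ ∷ x≢s) (_ ∷ ys) = (λ eq → x≢ (cong proj₁ eq)) ∷ first-differs x≢s ys

  Unique-cyclicPairs : {xs : List A} → Unique xs → Unique (cyclicPairs xs)
  Unique-cyclicPairs {xs} = Unique-zip⁺ (rotate xs)

  map-proj₁-cyclicPairs : ∀ (xs : List A) → map proj₁ (cyclicPairs xs) ≡ xs
  map-proj₁-cyclicPairs []       = refl
  map-proj₁-cyclicPairs (x ∷ xs) = go x xs x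
    where
    go : ∀ x xs y → map proj₁ (zip (x ∷ xs) (xs ∷ʳ y)) ≡ x ∷ xs
    go x []        y = refl
    go x (x′ ∷ xs) y = cong (x ∷_) (go x′ xs y)

  map-proj₂-cyclicPairs : ∀ (xs : List A) → map proj₂ (cyclicPairs xs) ≡ rotate xs
  map-proj₂-cyclicPairs []       = refl
  map-proj₂-cyclicPairs (x ∷ xs) = go x xs x
    where
    go : ∀ x xs y → map proj₂ (zip (x ∷ xs) (xs ∷ʳ y)) ≡ xs ∷ʳ y
    go x []        y = refl
    go x (x′ ∷ xs) y = cong (x′ ∷_) (go x′ xs y)

  rotate-↭ : ∀ (xs : List A) → rotate xs ↭ xs
  rotate-↭ []       = ↭-refl
  rotate-↭ (x ∷ xs) = ↭-sym (∷↭∷ʳ x xs)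

  All-cyclicPairs⁺ : ∀ {p} {P : A → Set p} {xs} → All P xs → All (λ q → P (proj₁ q)) (cyclicPairs xs)
  All-cyclicPairs⁺ {xs = xs} ps = All.map⁻ (subst (All _) (sym (map-proj₁-cyclicPairs xs)) ps)

  cyclicPairs-nonempty : ∀ (x : A) xs → ∃ λ p → p ∈ cyclicPairs (x ∷ xs)
  cyclicPairs-nonempty x []      = (x , x) , here refl
  cyclicPairs-nonempty x (y ∷ _) = (x , y) , here refl

Unique⇒length≤ : ∀ {n} {xs : List (Fin n)} → Unique xs → length xs ℕ.≤ n
Unique⇒length≤ {xs = xs} u = Fin.injective⇒≤ (lookup-injective xs u)
  where
  lookup-injective : ∀ xs → Unique xs → ∀ {i j} → lookup xs i ≡ lookup xs j → i ≡ j
  lookup-injective (x ∷ xs) (x∉ ∷ u) {Fin.zero}  {Fin.zero}  _ = refl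
  lookup-injective (x ∷ xs) (x∉ ∷ u) {Fin.zero}  {Fin.suc j} e = ⊥-elim (All.lookup x∉ (∈-lookup j) e)
  lookup-injective (x ∷ xs) (x∉ ∷ u) {Fin.suc i} {Fin.zero}  e = ⊥-elim (All.lookup x∉ (∈-lookup i) (sym e))
  lookup-injective (x ∷ xs) (x∉ ∷ u) {Fin.suc i} {Fin.suc j} e = cong Fin.suc (lookup-injective xs u e)

All-cyclicPairs-applyUpTo : ∀ {a r} {A : Set a} {R : A → A → Set r} (g : ℕ → A) d →
  (∀ i → R (g i) (g (suc i))) → R (g d) (g 0) →
  All (λ p → R (proj₁ p) (proj₂ p)) (cyclicPairs (applyUpTo g (suc d)))
All-cyclicPairs-applyUpTo {A = A} {R} g d step wrap = go g d step wrap
  where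
  go : ∀ (g : ℕ → A) d {e} → (∀ i → R (g i) (g (suc i))) → R (g d) e →
       All (λ p → R (proj₁ p) (proj₂ p)) (zip (g 0 ∷ applyUpTo (g ∘ suc) d) (applyUpTo (g ∘ suc) d ∷ʳ e))
  go g zero    step wrap = wrap ∷ []
  go g (suc d) step wrap = step 0 ∷ go (g ∘ suc) d (step ∘ suc) wrap

∈-before : ∀ {a} {A : Set a} (as : List A) {u bs} xs {t ys} → Unique (as ++ u ∷ bs) →
           as ++ u ∷ bs ≡ xs ++ t ∷ ys → u ∈ ys → t ∈ as
∈-before []       []       (u∉ ∷ _) refl u∈ = ⊥-elim (All.lookup u∉ u∈ refl)
∈-before []       (x ∷ xs) (u∉ ∷ _) refl u∈ = ⊥-elim (All.lookup u∉ (∈-++⁺ʳ xs (there u∈)) refl)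
∈-before (a ∷ as) []       _        refl _  = here refl
∈-before (a ∷ as) (x ∷ xs) (_ ∷ u)  eq   u∈ with ∷-injective eq
... | refl , eq′ = there (∈-before as xs u eq′ u∈)

module _ {a p q} {A : Set a} {P : A → Set p} {Q : A → Set q} where

  First-pin : ∀ {xs} → First P Q xs → ∃ λ x → First P (λ y → y ≡ x × Q y) xs
  First-pin First.[ qx ] = _ , First.[ refl , qx ]
  First-pin (px ∷ pq)    with First-pin pq
  ... | x , pq′ = x , px ∷ pq′

  First-pinned-∈ : ∀ {x xs} → First P (λ y → y ≡ x × Q y) xs → x ∈ xs
  First-pinned-∈ First.[ refl , _ ] = here refl
  First-pinned-∈ (_ ∷ pq)           = there (First-pinned-∈ pq)

  First-pinned-unique : (∀ {y} → P y → ¬ Q y) → ∀ {x x′ xs} →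
    First P (λ y → y ≡ x × Q y) xs → First P (λ y → y ≡ x′ × Q y) xs → x ≡ x′
  First-pinned-unique P⇒¬Q First.[ refl , _ ] First.[ refl , _ ] = refl
  First-pinned-unique P⇒¬Q First.[ _ , qy ]   (py ∷ _)           = ⊥-elim (P⇒¬Q py qy)
  First-pinned-unique P⇒¬Q (py ∷ _)           First.[ _ , qy ]   = ⊥-elim (P⇒¬Q py qy)
  First-pinned-unique P⇒¬Q (_ ∷ pq)           (_ ∷ pq′)          = First-pinned-unique P⇒¬Q pq pq′

  First-pinned-before : ∀ {r} {R : A → Set r} → (∀ {y} → P y → ¬ R y) → (∀ {y} → Q y → ¬ R y) →
    ∀ {x w xs} → First P (λ y → y ≡ x × Q y) xs → w ∈ xs → R w →
    ∃₂ λ ys zs → xs ≡ ys ++ x ∷ zs × w ∈ zs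
  First-pinned-before P⇒¬R Q⇒¬R First.[ refl , qx ] (here refl) Rw = ⊥-elim (Q⇒¬R qx Rw)
  First-pinned-before P⇒¬R Q⇒¬R First.[ refl , qx ] (there w∈)  Rw = [] , _ , refl , w∈
  First-pinned-before P⇒¬R Q⇒¬R (px ∷ pq)           (here refl) Rw = ⊥-elim (P⇒¬R px Rw)
  First-pinned-before P⇒¬R Q⇒¬R (px ∷ pq)           (there w∈)  Rw with First-pinned-before P⇒¬R Q⇒¬R pq w∈ Rw
  ... | ys , zs , eq , w∈zs = _ ∷ ys , zs , cong (_ ∷_) eq , w∈zs

module _ {b h c} {B : Set b} {H : B → Set h} {C : Set c} where

  concatAll : (∀ {x} → H x → List C) → ∀ {xs} → All H xs → List C
  concatAll g []       = []
  concatAll g (h ∷ hs) = g h ++ concatAll g hs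

  concatAll-↭ : ∀ {g g′ : ∀ {x} → H x → List C} → (∀ {x} (h : H x) → g h ↭ g′ h) →
                ∀ {xs} (hs : All H xs) → concatAll g hs ↭ concatAll g′ hs
  concatAll-↭ g↭g′ []       = ↭-refl
  concatAll-↭ g↭g′ (h ∷ hs) = ++⁺ (g↭g′ h) (concatAll-↭ g↭g′ hs)

  concatAll-++ : ∀ (g g′ : ∀ {x} → H x → List C) {xs} (hs : All H xs) →
                 concatAll g hs ++ concatAll g′ hs ↭ concatAll (λ h → g h ++ g′ h) hs
  concatAll-++ g g′ []       = ↭-refl
  concatAll-++ g g′ (h ∷ hs) = begin
    (g h ++ concatAll g hs) ++ g′ h ++ concatAll g′ hs ≡⟨ ++-assoc (g h) _ _ ⟩
    g h ++ concatAll g hs ++ g′ h ++ concatAll g′ hs   ↭⟨ ++⁺ˡ (g h) (shifts (concatAll g hs) (g′ h)) ⟩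
    g h ++ g′ h ++ concatAll g hs ++ concatAll g′ hs   ↭⟨ ++⁺ˡ (g h) (++⁺ˡ (g′ h) (concatAll-++ g g′ hs)) ⟩
    g h ++ g′ h ++ concatAll (λ h → g h ++ g′ h) hs    ≡⟨ ++-assoc (g h) (g′ h) _ ⟨
    (g h ++ g′ h) ++ concatAll (λ h → g h ++ g′ h) hs  ∎
    where open PermutationReasoning

  concatAll-const : ∀ (k : B → List C) {xs} (hs : All H xs) → concatAll (λ {x} _ → k x) hs ≡ concatMap k xs
  concatAll-const k []       = refl
  concatAll-const k (h ∷ hs) = cong (k _ ++_) (concatAll-const k hs)

  ∈-concatAll : ∀ (g : ∀ {x} → H x → List C) {xs} (hs : All H xs) {x c} (x∈ : x ∈ xs) →
                c ∈ g (All.lookup hs x∈) → c ∈ concatAll g hs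
  ∈-concatAll g (h ∷ hs) (here refl) c∈ = ∈-++⁺ˡ c∈
  ∈-concatAll g (h ∷ hs) (there x∈)  c∈ = ∈-++⁺ʳ (g h) (∈-concatAll g hs x∈ c∈)

  concatAll-All : ∀ {p} {P : C → Set p} (g : ∀ {x} → H x → List C) → (∀ {x} (h : H x) → All P (g h)) →
                  ∀ {xs} (hs : All H xs) → All P (concatAll g hs)
  concatAll-All g all []       = []
  concatAll-All g all (h ∷ hs) = All.++⁺ (all h) (concatAll-All g all hs)

module _ {a r} {A : Set a} {R : A → A → Set r} where

  arcs : ∀ {x y} → Star R x y → List (A × A)
  arcs ε                 = []
  arcs (_◅_ {x} {y} _ w) = (x , y) ∷ arcs w

  sources : ∀ {x y} → Star R x y → List A
  sources ε             = []
  sources (_◅_ {x} _ w) = x ∷ sources w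

  targets : ∀ {x y} → Star R x y → List A
  targets ε                 = []
  targets (_◅_ {_} {y} _ w) = y ∷ targets w

  vertices : ∀ {x y} → Star R x y → List A
  vertices {x} w = x ∷ targets w

  arcs-All : ∀ {x y} (w : Star R x y) → All (uncurry R) (arcs w)
  arcs-All ε       = []
  arcs-All (r ◅ w) = r ∷ arcs-All w

  arcs-◅◅ : ∀ {x y z} (w : Star R x y) (w′ : Star R y z) → arcs (w ◅◅ w′) ≡ arcs w ++ arcs w′
  arcs-◅◅ ε       w′ = refl
  arcs-◅◅ (r ◅ w) w′ = cong (_ ∷_) (arcs-◅◅ w w′)

  vertices-◅◅ˡ : ∀ {x y z} (w : Star R x y) (w′ : Star R y z) →
                 vertices (w ◅◅ w′) ≡ vertices w ++ targets w′
  vertices-◅◅ˡ ε       w′ = refl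
  vertices-◅◅ˡ {x} (r ◅ w) w′ = cong (x ∷_) (vertices-◅◅ˡ w w′)

  vertices-◅◅ʳ : ∀ {x y z} (w : Star R x y) (w′ : Star R y z) →
                 vertices (w ◅◅ w′) ≡ sources w ++ vertices w′
  vertices-◅◅ʳ ε       w′ = refl
  vertices-◅◅ʳ {x} (r ◅ w) w′ = cong (x ∷_) (vertices-◅◅ʳ w w′)

  vertices≡sources∷ʳ : ∀ {x y} (w : Star R x y) → vertices w ≡ sources w ∷ʳ y
  vertices≡sources∷ʳ ε       = refl
  vertices≡sources∷ʳ {x} (r ◅ w) = cong (x ∷_) (vertices≡sources∷ʳ w)

  zip-sources-targets : ∀ {x y} (w : Star R x y) → zip (sources w) (targets w) ≡ arcs w
  zip-sources-targets ε       = refl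
  zip-sources-targets (r ◅ w) = cong (_ ∷_) (zip-sources-targets w)

  cyclicPairs-sources : ∀ {x} (w : Star R x x) → cyclicPairs (sources w) ≡ arcs w
  cyclicPairs-sources ε               = refl
  cyclicPairs-sources {x} (r ◅ w) = begin
    zip (x ∷ sources w) (sources w ∷ʳ x) ≡⟨ cong (zip (x ∷ sources w)) (sym (vertices≡sources∷ʳ w)) ⟩
    zip (x ∷ sources w) (vertices w)     ≡⟨ cong (_ ∷_) (zip-sources-targets w) ⟩
    arcs (r ◅ w)                         ∎
    where open ≡-Reasoning

  linkPairs-vertices : ∀ {x y} (w : Star R x y) → linkPairs (vertices w) ≡ arcs w
  linkPairs-vertices ε       = refl
  linkPairs-vertices (r ◅ w) = cong (_ ∷_) (linkPairs-vertices w)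

  last-vertices : ∀ {x y} (w : Star R x y) → last (vertices w) ≡ just y
  last-vertices ε       = refl
  last-vertices (r ◅ w) = last-vertices w

  ∈-vertices : ∀ {x y} (w : Star R x y) → y ∈ vertices w
  ∈-vertices ε       = here refl
  ∈-vertices (r ◅ w) = there (∈-vertices w)

  split-at : ∀ {x y z} (w : Star R x y) → z ∈ vertices w →
             Σ (Star R x z) λ w₁ → Σ (Star R z y) λ w₂ → w ≡ w₁ ◅◅ w₂
  split-at w       (here refl) = ε , w , refl
  split-at (r ◅ w) (there z∈)  with split-at w z∈
  ... | w₁ , w₂ , refl = r ◅ w₁ , w₂ , refl

  split-at-unique : ∀ {x y z} (w : Star R x y) → Unique (vertices w) → z ∈ vertices w →
    Σ (Star R x z) λ w₁ → Σ (Star R z y) λ w₂ →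
      w ≡ w₁ ◅◅ w₂ × Unique (vertices w₁) × Unique (vertices w₂)
  split-at-unique w u z∈ with split-at w z∈
  ... | w₁ , w₂ , refl =
    w₁ , w₂ , refl ,
    Unique-++⁻ˡ (vertices w₁) (subst Unique (vertices-◅◅ˡ w₁ w₂) u) ,
    Unique-++⁻ʳ (sources w₁) (subst Unique (vertices-◅◅ʳ w₁ w₂) u)

  split-arc : ∀ {x y a b} (w : Star R x y) → (a , b) ∈ arcs w →
    Σ (Star R x a) λ w₁ → Σ (R a b) λ r → Σ (Star R b y) λ w₂ → w ≡ w₁ ◅◅ r ◅ w₂
  split-arc (r ◅ w) (here refl) = ε , r , w , refl
  split-arc (r ◅ w) (there ab∈) with split-arc w ab∈
  ... | w₁ , r′ , w₂ , refl = r ◅ w₁ , r′ , w₂ , refl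

  rotate-at : ∀ {x a b} (w : Star R x x) → (a , b) ∈ arcs w →
              Σ (Star R b a) λ w′ → (a , b) ∷ arcs w′ ↭ arcs w
  rotate-at {a = a} {b} w ab∈ with split-arc w ab∈
  ... | w₁ , r , w₂ , refl = w₂ ◅◅ w₁ , (begin
    (a , b) ∷ arcs (w₂ ◅◅ w₁)    ≡⟨ cong (_ ∷_) (arcs-◅◅ w₂ w₁) ⟩
    ((a , b) ∷ arcs w₂) ++ arcs w₁ ↭⟨ ++-comm ((a , b) ∷ arcs w₂) (arcs w₁) ⟩
    arcs w₁ ++ arcs (r ◅ w₂)      ≡⟨ arcs-◅◅ w₁ (r ◅ w₂) ⟨
    arcs (w₁ ◅◅ r ◅ w₂)           ∎)
    where open PermutationReasoning

  zipWalk : ∀ x xs y → All (uncurry R) (zip (x ∷ xs) (xs ∷ʳ y)) →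
            Σ (Star R x y) λ w → arcs w ≡ zip (x ∷ xs) (xs ∷ʳ y)
  zipWalk x []        y (r ∷ []) = r ◅ ε , refl
  zipWalk x (x′ ∷ xs) y (r ∷ rs) with zipWalk x′ xs y rs
  ... | w , eq = r ◅ w , cong (_ ∷_) eq

  linkWalk : ∀ t ws {u} → last (t ∷ ws) ≡ just u → All (uncurry R) (linkPairs (t ∷ ws)) → Star R t u
  linkWalk t []        refl []       = ε
  linkWalk t (t′ ∷ ws) eq   (r ∷ rs) = r ◅ linkWalk t′ ws eq rs

module _ {n r} {R : Fin n → Fin n → Set r} where

  private
    _∈?_ = DecMembership._∈?_ (Fin._≟_ {n})

  closedPath⇒IsCycle : ∀ {x y} (r : R x y) (p : Star R y x) → Unique (vertices p) →
                       IsCycle R (sources (r ◅ p))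
  closedPath⇒IsCycle {x} r p u =
    (λ ()) ,
    Unique-resp-↭ (↭-sym (∷↭∷ʳ x (sources p))) (subst Unique (vertices≡sources∷ʳ p) u) ,
    subst (All (uncurry R)) (sym (cyclicPairs-sources (r ◅ p))) (arcs-All (r ◅ p))

  Acyclic⇒Unique-vertices : Acyclic R → ∀ {x y} (w : Star R x y) → Unique (vertices w)
  Acyclic⇒Unique-vertices acyclic ε = [] ∷ []
  Acyclic⇒Unique-vertices acyclic {x} (r ◅ w) with x ∈? vertices w
  ... | no x∉ = All.¬Any⇒All¬ _ x∉ ∷ Acyclic⇒Unique-vertices acyclic w
  ... | yes x∈ with split-at-unique w (Acyclic⇒Unique-vertices acyclic w) x∈
  ...   | p , _ , refl , u , _ = ⊥-elim (acyclic (_ , closedPath⇒IsCycle r p u))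

  record PathAndCycles {x y} (w : Star R x y) : Set r where
    field
      path        : Star R x y
      path-unique : Unique (vertices path)
      cycles      : List (List (Fin n))
      cycles-ok   : All (IsCycle R) cycles
      arcs-↭      : arcs path ++ concatMap cyclicPairs cycles ↭ arcs w

  decompose : ∀ {x y} (w : Star R x y) → PathAndCycles w
  decompose ε = record { path = ε ; path-unique = [] ∷ [] ; cycles = [] ; cycles-ok = [] ; arcs-↭ = ↭-refl }
  decompose {x} (r ◅ w) with decompose w
  ... | record { path = p ; path-unique = u ; cycles = Cs ; cycles-ok = ok ; arcs-↭ = p↭w } with x ∈? vertices p
  ...   | no x∉ = record
    { path = r ◅ p ; path-unique = All.¬Any⇒All¬ _ x∉ ∷ u ; cycles = Cs ; cycles-ok = ok ; arcs-↭ = ↭-prep _ p↭w }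
  ...   | yes x∈ with split-at-unique p u x∈
  ...     | p₁ , p₂ , refl , u₁ , u₂ = record
    { path = p₂ ; path-unique = u₂ ; cycles = sources (r ◅ p₁) ∷ Cs
    ; cycles-ok = closedPath⇒IsCycle r p₁ u₁ ∷ ok ; arcs-↭ = rearranged }
    where
    open PermutationReasoning
    C* = concatMap cyclicPairs Cs
    rearranged : arcs p₂ ++ cyclicPairs (sources (r ◅ p₁)) ++ C* ↭ arcs (r ◅ w)
    rearranged = begin
      arcs p₂ ++ cyclicPairs (sources (r ◅ p₁)) ++ C*
                                                      ≡⟨ cong (λ l → arcs p₂ ++ l ++ C*) (cyclicPairs-sources (r ◅ p₁)) ⟩
      arcs p₂ ++ arcs (r ◅ p₁) ++ C*                  ↭⟨ shifts (arcs p₂) (arcs (r ◅ p₁)) ⟩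
      _ ∷ arcs p₁ ++ arcs p₂ ++ C*                    ≡⟨ cong (_ ∷_) (++-assoc (arcs p₁) (arcs p₂) C*) ⟨
      _ ∷ (arcs p₁ ++ arcs p₂) ++ C*                  ≡⟨ cong (λ l → _ ∷ l ++ C*) (arcs-◅◅ p₁ p₂) ⟨
      _ ∷ arcs (p₁ ◅◅ p₂) ++ C*                       ↭⟨ ↭-prep _ p↭w ⟩
      arcs (r ◅ w)                                    ∎

  closedWalk⇒cycles : ∀ {x} (w : Star R x x) →
    Σ (List (List (Fin n))) λ Cs → All (IsCycle R) Cs × concatMap cyclicPairs Cs ↭ arcs w
  closedWalk⇒cycles w with decompose w
  ... | record { path = p ; path-unique = u ; cycles = Cs ; cycles-ok = ok ; arcs-↭ = p↭w } =
    Cs , ok , subst (λ l → l ++ concatMap cyclicPairs Cs ↭ arcs w) (closedPath-arcs p u) p↭w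
    where
    closedPath-arcs : ∀ {x} (p : Star R x x) → Unique (vertices p) → arcs p ≡ []
    closedPath-arcs ε       _        = refl
    closedPath-arcs (r ◅ p) (x∉ ∷ _) = ⊥-elim (All.lookup x∉ (∈-vertices p) refl)

  cycle-segment : ∀ {C a b} → IsCycle R C → (a , b) ∈ cyclicPairs C →
                  Σ (Star R b a) λ w → (a , b) ∷ arcs w ↭ cyclicPairs C
  cycle-segment {[]}     (C≢[] , _) _ = ⊥-elim (C≢[] refl)
  cycle-segment {c ∷ cs} (_ , _ , rs) ab∈ with zipWalk c cs c rs
  ... | w , arcs≡ =
    subst (λ l → Σ (Star R _ _) λ w′ → _ ∷ arcs w′ ↭ l) arcs≡ (rotate-at w (subst (_ ∈_) (sym arcs≡) ab∈))

  PathVia⇒Star : ∀ {v t u} → PathVia R v t u → R v t × Star R t u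
  PathVia⇒Star {t = t} (ws , _ , r ∷ rs , last≡u) = r , linkWalk t ws last≡u rs

  Star⇒PathVia : ∀ {x t y} (r : R x t) (w : Star R t y) → Unique (vertices (r ◅ w)) → PathVia R x t y
  Star⇒PathVia r w u =
    targets w , u , subst (All (uncurry R)) (sym (linkPairs-vertices (r ◅ w))) (arcs-All (r ◅ w)) , last-vertices w

PathVia-map : ∀ {n r s} {R : Fin n → Fin n → Set r} {S : Fin n → Fin n → Set s} →
              (∀ {x y} → R x y → S x y) → ∀ {v t u} → PathVia R v t u → PathVia S v t u
PathVia-map f (ws , u , arcs , last≡) = ws , u , All.map f arcs , last≡

module _ {n r p} {R : Fin n → Fin n → Set r} {P : Fin n → Set p}
         (acyclic : Acyclic R) (progress : ∀ v → P v ⊎ ∃ (R v)) where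

  private
    follow : ∀ k {z y} → R z y →
      (∃₂ λ z′ w → Star R y w × R z′ w × P w) ⊎ (∃ λ w → Σ (Star R y w) λ ω → k ℕ.≤ length (targets ω))
    follow zero          r = inj₂ (_ , ε , ℕ.z≤n)
    follow (suc k) {z} {y} r with progress y
    ... | inj₁ Py       = inj₁ (z , y , ε , r , Py)
    ... | inj₂ (y′ , r′) with follow k r′
    ...   | inj₁ (z′ , w , ω , r″ , Pw) = inj₁ (z′ , w , r′ ◅ ω , r″ , Pw)
    ...   | inj₂ (w , ω , k≤)          = inj₂ (w , r′ ◅ ω , ℕ.s≤s k≤)

  descend : ∀ {x t} → R x t → ∃₂ λ z w → PathVia R x t w × R z w × P w
  descend r with follow n r
  ... | inj₁ (z , w , ω , r′ , Pw) = z , w , Star⇒PathVia r ω (Acyclic⇒Unique-vertices acyclic (r ◅ ω)) , r′ , Pw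
  ... | inj₂ (w , ω , n≤)          = -- a walk with n arcs cannot have n + 1 distinct vertices
    ⊥-elim (ℕ.<-irrefl refl (ℕ.≤-trans (ℕ.s≤s n≤) (Unique⇒length≤ (Acyclic⇒Unique-vertices acyclic ω))))

module _ {a q r h} {A : Set a} {Q : Set q} {R : A → A → Set r} {H : Q × Q → Set h}
         (f : Q → A) (walk : ∀ {p} → H p → Star R (f (proj₁ p)) (f (proj₂ p))) where

  chain : ∀ q qs e (hs : All H (zip (q ∷ qs) (qs ∷ʳ e))) →
          Σ (Star R (f q) (f e)) λ w → arcs w ≡ concatAll (λ h → arcs (walk h)) hs
  chain q []        e (h ∷ []) = walk h , sym (++-identityʳ _)
  chain q (q′ ∷ qs) e (h ∷ hs) with chain q′ qs e hs
  ... | w , arcs≡ = walk h ◅◅ w , trans (arcs-◅◅ (walk h) w) (cong (arcs (walk h) ++_) arcs≡)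

  closedChain : ∀ q qs (hs : All H (cyclicPairs (q ∷ qs))) →
                Σ (Star R (f q) (f q)) λ w → arcs w ≡ concatAll (λ h → arcs (walk h)) hs
  closedChain q qs = chain q qs q

arcs-map : ∀ {a r s} {A : Set a} {R : A → A → Set r} {S : A → A → Set s} (g : ∀ {x y} → R x y → S x y) →
           ∀ {x y} (w : Star R x y) → arcs (Star.map g w) ≡ arcs w
arcs-map g ε       = refl
arcs-map g (r ◅ w) = cong (_ ∷_) (arcs-map g w)

module OrderedFieldProperties {c ℓ} (F : OrderedField c ℓ) where

  open OrderedField F public

  commutativeRing : CommutativeRing c ℓ
  commutativeRing = record { isCommutativeRing = isCommutativeRing }

  open CommutativeRing commutativeRing public
    using (setoid; semiring; +-cong; +-congˡ; +-congʳ; +-comm; +-assoc; +-identityˡ; +-identityʳ;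
           -‿inverseˡ; -‿inverseʳ)
    renaming (refl to ≈-refl; sym to ≈-sym; trans to ≈-trans)
  open SemiringMult semiring public using () renaming (_×_ to _·_)

  private
    open CommutativeRing commutativeRing using (ring; -‿cong; *-congˡ; *-identityˡ; *-identityʳ; zeroʳ)
    open RingProperties ring using (-‿distribʳ-*)
    open SemiringMult semiring using (×-congʳ; ×-assoc-*; ×-comm-*)
    module STO = IsStrictTotalOrder isStrictTotalOrder

  open STO public using (compare; _<?_) renaming (_≟_ to _≈?_)

  <-irrefl : ∀ {a b} → a ≈ b → ¬ (a < b)
  <-irrefl = STO.irrefl

  <-trans : ∀ {a b d} → a < b → b < d → a < d
  <-trans = STO.trans

  <-respʳ-≈ : ∀ {a b d} → b ≈ d → a < b → a < d
  <-respʳ-≈ = STO.<-respʳ-≈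

  <-respˡ-≈ : ∀ {a b d} → a ≈ d → a < b → d < b
  <-respˡ-≈ = STO.<-respˡ-≈

  <-asym : ∀ {a b} → a < b → ¬ (b < a)
  <-asym a<b b<a = <-irrefl ≈-refl (<-trans a<b b<a)

  ≤-refl : ∀ {a} → a ≤ a
  ≤-refl = inj₂ ≈-refl

  <⇒≤ : ∀ {a b} → a < b → a ≤ b
  <⇒≤ = inj₁

  <-≤-trans : ∀ {a b d} → a < b → b ≤ d → a < d
  <-≤-trans a<b (inj₁ b<d) = <-trans a<b b<d
  <-≤-trans a<b (inj₂ b≈d) = <-respʳ-≈ b≈d a<b

  ≤-<-trans : ∀ {a b d} → a ≤ b → b < d → a < d
  ≤-<-trans (inj₁ a<b) b<d = <-trans a<b b<d
  ≤-<-trans (inj₂ a≈b) b<d = <-respˡ-≈ (≈-sym a≈b) b<d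

  ≤-trans : ∀ {a b d} → a ≤ b → b ≤ d → a ≤ d
  ≤-trans (inj₁ a<b) b≤d       = inj₁ (<-≤-trans a<b b≤d)
  ≤-trans (inj₂ a≈b) (inj₁ b<d) = inj₁ (<-respˡ-≈ (≈-sym a≈b) b<d)
  ≤-trans (inj₂ a≈b) (inj₂ b≈d) = inj₂ (≈-trans a≈b b≈d)

  ≤-respˡ-≈ : ∀ {a b d} → a ≈ d → a ≤ b → d ≤ b
  ≤-respˡ-≈ a≈d a≤b = ≤-trans (inj₂ (≈-sym a≈d)) a≤b

  ≮⇒≥ : ∀ {a b} → ¬ (a < b) → b ≤ a
  ≮⇒≥ {a} {b} a≮b with compare a b
  ... | tri< a<b _   _   = ⊥-elim (a≮b a<b)
  ... | tri≈ _   a≈b _   = inj₂ (≈-sym a≈b)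
  ... | tri> _   _   b<a = inj₁ b<a

  +-monoˡ-< : ∀ {a b} d → a < b → a + d < b + d
  +-monoˡ-< = +-mono-<

  +-monoʳ-< : ∀ {a b} d → a < b → d + a < d + b
  +-monoʳ-< d a<b = <-respˡ-≈ (+-comm _ d) (<-respʳ-≈ (+-comm _ d) (+-mono-< d a<b))

  +-monoˡ-≤ : ∀ {a b} d → a ≤ b → a + d ≤ b + d
  +-monoˡ-≤ d (inj₁ a<b) = inj₁ (+-monoˡ-< d a<b)
  +-monoˡ-≤ d (inj₂ a≈b) = inj₂ (+-congʳ a≈b)

  +-monoʳ-≤ : ∀ {a b} d → a ≤ b → d + a ≤ d + b
  +-monoʳ-≤ d (inj₁ a<b) = inj₁ (+-monoʳ-< d a<b)
  +-monoʳ-≤ d (inj₂ a≈b) = inj₂ (+-congˡ a≈b)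

  +-mono-≤ : ∀ {a b d e} → a ≤ b → d ≤ e → a + d ≤ b + e
  +-mono-≤ {b = b} {d} a≤b d≤e = ≤-trans (+-monoˡ-≤ d a≤b) (+-monoʳ-≤ b d≤e)

  +-mono-<-≤ : ∀ {a b d e} → a < b → d ≤ e → a + d < b + e
  +-mono-<-≤ {b = b} {d} a<b d≤e = <-≤-trans (+-monoˡ-< d a<b) (+-monoʳ-≤ b d≤e)

  +-mono-≤-< : ∀ {a b d e} → a ≤ b → d < e → a + d < b + e
  +-mono-≤-< {b = b} {d} a≤b d<e = ≤-<-trans (+-monoˡ-≤ d a≤b) (+-monoʳ-< b d<e)

  x≤x+y : ∀ {x y} → 0# ≤ y → x ≤ x + y
  x≤x+y {x} 0≤y = ≤-respˡ-≈ (+-identityʳ x) (+-monoʳ-≤ x 0≤y)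

  x<x+y : ∀ {x y} → 0# < y → x < x + y
  x<x+y {x} 0<y = <-respˡ-≈ (+-identityʳ x) (+-monoʳ-< x 0<y)

  +-nonneg : ∀ {a b} → 0# ≤ a → 0# ≤ b → 0# ≤ a + b
  +-nonneg 0≤a 0≤b = ≤-respˡ-≈ (+-identityʳ 0#) (+-mono-≤ 0≤a 0≤b)

  x-y+y≈x : ∀ x y → (x + - y) + y ≈ x
  x-y+y≈x x y = ≈-trans (+-assoc x (- y) y) (≈-trans (+-congˡ (-‿inverseˡ y)) (+-identityʳ x))

  x+y-y≈x : ∀ x y → (x + y) + - y ≈ x
  x+y-y≈x x y = ≈-trans (+-assoc x y (- y)) (≈-trans (+-congˡ (-‿inverseʳ y)) (+-identityʳ x))

  x+y<z⇒y<z-x : ∀ {x y z} → x + y < z → y < z + - x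
  x+y<z⇒y<z-x {x} {y} lt = <-respˡ-≈ (≈-trans (+-congʳ (+-comm x y)) (x+y-y≈x y x)) (+-monoˡ-< (- x) lt)

  y<z-x⇒x+y<z : ∀ {x y z} → y < z + - x → x + y < z
  y<z-x⇒x+y<z {x} {y} {z} lt = <-respʳ-≈ (≈-trans (+-comm x _) (x-y+y≈x z x)) (+-monoʳ-< x lt)

  x<y⇒0<y-x : ∀ {x y} → x < y → 0# < y + - x
  x<y⇒0<y-x {x} lt = <-respˡ-≈ (-‿inverseʳ x) (+-monoˡ-< (- x) lt)

  ·-nonneg : ∀ k {e} → 0# ≤ e → 0# ≤ k · e
  ·-nonneg zero    0≤e = ≤-refl
  ·-nonneg (suc k) 0≤e = +-nonneg 0≤e (·-nonneg k 0≤e)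

  ·-monoˡ-≤ : ∀ {j k e} → j ℕ.≤ k → 0# ≤ e → j · e ≤ k · e
  ·-monoˡ-≤ {k = k} ℕ.z≤n     0≤e = ·-nonneg k 0≤e
  ·-monoˡ-≤         (ℕ.s≤s j≤k) 0≤e = +-monoʳ-≤ _ (·-monoˡ-≤ j≤k 0≤e)

  ·-<-suc : ∀ k {e} → 0# < e → k · e < suc k · e
  ·-<-suc k {e} 0<e = <-respˡ-≈ (+-identityˡ (k · e)) (+-monoˡ-< (k · e) 0<e)

  ·-pos : ∀ k {e} → 0# < e → 0# < suc k · e
  ·-pos k 0<e = ≤-<-trans (·-nonneg k (<⇒≤ 0<e)) (·-<-suc k 0<e)

  positive-inverse : ∀ {x} → 0# < x → ∃ λ y → 0# < y × x * y ≈ 1#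
  positive-inverse {x} 0<x with inverse x (λ x≈0 → <-irrefl (≈-sym x≈0) 0<x)
  ... | y , xy≈1 with compare 0# y
  ...   | tri< 0<y _ _ = y , 0<y , xy≈1
  ...   | tri≈ _ 0≈y _ = ⊥-elim (<-irrefl 0≈1 0<1)
    where
    0≈1 : 0# ≈ 1#
    0≈1 = ≈-trans (≈-sym (zeroʳ x)) (≈-trans (*-congˡ 0≈y) xy≈1)
  ...   | tri> _ _ y<0 = ⊥-elim (<-asym 0<1 1<0)
    where
    0<-1 : 0# < - 1#
    0<-1 = <-respʳ-≈ (≈-trans (≈-sym (-‿distribʳ-* x y)) (-‿cong xy≈1))
             (*-pos 0<x (<-respˡ-≈ (-‿inverseʳ y) (<-respʳ-≈ (+-identityˡ (- y)) (+-monoˡ-< (- y) y<0))))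
    1<0 : 1# < 0#
    1<0 = <-respˡ-≈ (+-identityˡ 1#) (<-respʳ-≈ (-‿inverseˡ 1#) (+-monoˡ-< 1# 0<-1))

  ∃-small-multiple : ∀ K {m} → 0# < m → ∃ λ e → 0# < e × K · e < m
  ∃-small-multiple K {m} 0<m with positive-inverse (·-pos K 0<1)
  ... | y , 0<y , [K+1]y≈1 = m * y , *-pos 0<m 0<y , <-respʳ-≈ [K+1]my≈m (·-<-suc K (*-pos 0<m 0<y))
    where
    open SetoidReasoning setoid
    [K+1]my≈m : suc K · (m * y) ≈ m
    [K+1]my≈m = begin
      suc K · (m * y)       ≈⟨ ×-comm-* (suc K) m y ⟨
      m * (suc K · y)       ≈⟨ *-congˡ (×-congʳ (suc K) (*-identityˡ y)) ⟨
      m * (suc K · (1# * y)) ≈⟨ *-congˡ (×-assoc-* (suc K) 1# y) ⟨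
      m * ((suc K · 1#) * y) ≈⟨ *-congˡ [K+1]y≈1 ⟩
      m * 1#                ≈⟨ *-identityʳ m ⟩
      m                     ∎

  ∃-lower-bound : ∀ xs → All (0# <_) xs → ∃ λ m → 0# < m × All (m ≤_) xs
  ∃-lower-bound []       []          = 1# , 0<1 , []
  ∃-lower-bound (x ∷ xs) (0<x ∷ 0<xs) with ∃-lower-bound xs 0<xs
  ... | m , 0<m , m≤xs with compare x m
  ...   | tri< x<m _ _ = x , 0<x , ≤-refl ∷ All.map (≤-trans (<⇒≤ x<m)) m≤xs
  ...   | tri≈ _ x≈m _ = x , 0<x , ≤-refl ∷ All.map (≤-trans (inj₂ x≈m)) m≤xs
  ...   | tri> _ _ m<x = m , 0<m , <⇒≤ m<x ∷ m≤xs

  ∃-uniform-step : ∀ K (gaps : List (Carrier × Carrier)) → All (uncurry _<_) gaps →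
                   ∃ λ e → 0# < e × All (λ g → proj₁ g + K · e < proj₂ g) gaps
  ∃-uniform-step K gaps a<b with ∃-lower-bound (map (λ g → proj₂ g + - proj₁ g) gaps) (All.map⁺ (All.map x<y⇒0<y-x a<b))
  ... | m , 0<m , m≤ with ∃-small-multiple K 0<m
  ...   | e , 0<e , Ke<m = e , 0<e , All.map (λ m≤g → y<z-x⇒x+y<z (<-≤-trans Ke<m m≤g)) (All.map⁻ m≤)

module FiniteSums {c ℓ} (F : OrderedField c ℓ) where

  open OrderedFieldProperties F
  open SemiringSum semiring public using (sum; sum-syntax; sum-cong-≋; ∑-distrib-+)

  sum-zero : ∀ {m} (f : Fin m → Carrier) → (∀ y → f y ≈ 0#) → sum f ≈ 0#
  sum-zero {zero}  f f≈0 = ≈-refl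
  sum-zero {suc m} f f≈0 =
    ≈-trans (+-cong (f≈0 Fin.zero) (sum-zero (λ y → f (Fin.suc y)) (λ y → f≈0 (Fin.suc y)))) (+-identityʳ 0#)

  sum-point : ∀ {m} (f : Fin m → Carrier) b → (∀ y → y ≢ b → f y ≈ 0#) → sum f ≈ f b
  sum-point {suc m} f Fin.zero f≈0 =
    ≈-trans (+-congˡ (sum-zero (λ y → f (Fin.suc y)) (λ y → f≈0 (Fin.suc y) (λ ())))) (+-identityʳ _)
  sum-point {suc m} f (Fin.suc b) f≈0 = ≈-trans (+-cong (f≈0 Fin.zero (λ ())) rest) (+-identityˡ _)
    where
    rest = sum-point (λ y → f (Fin.suc y)) b (λ y y≢b → f≈0 (Fin.suc y) (λ eq → y≢b (Fin.suc-injective eq)))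

  sum-mono-≤ : ∀ {m} {f g : Fin m → Carrier} → (∀ i → f i ≤ g i) → sum f ≤ sum g
  sum-mono-≤ {zero}  f≤g = ≤-refl
  sum-mono-≤ {suc m} f≤g = +-mono-≤ (f≤g Fin.zero) (sum-mono-≤ (λ i → f≤g (Fin.suc i)))

  sum-mono-< : ∀ {m} {f g : Fin m → Carrier} → (∀ i → f i ≤ g i) → ∀ j → f j < g j → sum f < sum g
  sum-mono-< {suc m} f≤g Fin.zero    f<g = +-mono-<-≤ f<g (sum-mono-≤ (λ i → f≤g (Fin.suc i)))
  sum-mono-< {suc m} f≤g (Fin.suc j) f<g = +-mono-≤-< (f≤g Fin.zero) (sum-mono-< (λ i → f≤g (Fin.suc i)) j f<g)

module Load {c ℓ} (F : OrderedField c ℓ) {b} {B : Set b} (_≟_ : DecidableEquality B) where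

  open OrderedFieldProperties F

  δ : Carrier → B → B → Carrier
  δ e x y = if does (x ≟ y) then e else 0#

  δ-≡ : ∀ e x → δ e x x ≈ e
  δ-≡ e x with x ≟ x
  ... | yes _  = ≈-refl
  ... | no x≢x = ⊥-elim (x≢x refl)

  δ-≢ : ∀ e {x y} → x ≢ y → δ e x y ≈ 0#
  δ-≢ e {x} {y} x≢y with x ≟ y
  ... | yes x≡y = ⊥-elim (x≢y x≡y)
  ... | no _    = ≈-refl

  δ-nonneg : ∀ {e} → 0# ≤ e → ∀ x y → 0# ≤ δ e x y
  δ-nonneg 0≤e x y with x ≟ y
  ... | yes _ = 0≤e
  ... | no _  = ≤-refl

  load : Carrier → List B → B → Carrier
  load e []      x = 0#
  load e (y ∷ L) x = δ e x y + load e L x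

  load-++ : ∀ e L M x → load e (L ++ M) x ≈ load e L x + load e M x
  load-++ e []      M x = ≈-sym (+-identityˡ _)
  load-++ e (y ∷ L) M x = ≈-trans (+-congˡ (load-++ e L M x)) (≈-sym (+-assoc _ _ _))

  load-↭ : ∀ e {L M} → L ↭ M → ∀ x → load e L x ≈ load e M x
  load-↭ e ↭.refl         x = ≈-refl
  load-↭ e (↭.prep y L↭M) x = +-congˡ (load-↭ e L↭M x)
  load-↭ e (↭.swap y z L↭M) x =
    ≈-trans (≈-sym (+-assoc _ _ _)) (≈-trans (+-cong (+-comm _ _) (load-↭ e L↭M x)) (+-assoc _ _ _))
  load-↭ e (↭.trans L↭M M↭N) x = ≈-trans (load-↭ e L↭M x) (load-↭ e M↭N x)

  load-∉ : ∀ e {L x} → x ∉ L → load e L x ≈ 0#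
  load-∉ e {[]}    x∉ = ≈-refl
  load-∉ e {y ∷ L} x∉ =
    ≈-trans (+-cong (δ-≢ e (λ x≡y → x∉ (here x≡y))) (load-∉ e (λ x∈ → x∉ (there x∈)))) (+-identityʳ 0#)

  load-nonneg : ∀ {e} → 0# ≤ e → ∀ L x → 0# ≤ load e L x
  load-nonneg 0≤e []      x = ≤-refl
  load-nonneg 0≤e (y ∷ L) x = +-nonneg (δ-nonneg 0≤e x y) (load-nonneg 0≤e L x)

  load-pos : ∀ {e} → 0# < e → ∀ {L x} → x ∈ L → 0# < load e L x
  load-pos {e} 0<e {y ∷ L} (here refl) =
    <-≤-trans (<-respʳ-≈ (≈-sym (δ-≡ e y)) 0<e) (x≤x+y (load-nonneg (<⇒≤ 0<e) L y))
  load-pos {e} 0<e {y ∷ L} {x} (there x∈) =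
    <-respˡ-≈ (+-identityˡ 0#) (+-mono-≤-< (δ-nonneg (<⇒≤ 0<e) x y) (load-pos 0<e x∈))

  load-≤ : ∀ {e} → 0# ≤ e → ∀ L x → load e L x ≤ length L · e
  load-≤ 0≤e []      x = ≤-refl
  load-≤ 0≤e (y ∷ L) x = +-mono-≤ (δ-≤ (x ≟ y)) (load-≤ 0≤e L x)
    where
    δ-≤ : ∀ (d : Dec (x ≡ y)) → (if does d then _ else 0#) ≤ _
    δ-≤ (yes _) = ≤-refl
    δ-≤ (no _)  = 0≤e

  load-unique : ∀ e {L} → Unique L → ∀ x →
                load e L x ≈ (if does (DecMembership._∈?_ _≟_ x L) then e else 0#)
  load-unique e {[]}    _          x = ≈-refl
  load-unique e {y ∷ L} (y∉ ∷ u) x with x ≟ y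
  ... | yes refl = ≈-trans (+-congˡ (load-∉ e (λ x∈ → All.lookup y∉ x∈ refl))) (+-identityʳ e)
  ... | no _     = ≈-trans (+-identityˡ _) (load-unique e u x)

module Flows {c ℓ} (F : OrderedField c ℓ) {n} (I : PX F n) where

  open OrderedFieldProperties F
  open FiniteSums F
  open PX I

  Packing : Set c
  Packing = List (List (Fin n) × Carrier)

  _≟ᵃ_ : DecidableEquality (Fin n × Fin n)
  _≟ᵃ_ = ≡-dec Fin._≟_ Fin._≟_

  open Load F _≟ᵃ_ public
  module Vertex = Load F (Fin._≟_ {n})

  _∈ᵃ?_ : ∀ p (L : List (Fin n × Fin n)) → Dec (p ∈ L)
  _∈ᵃ?_ = DecMembership._∈?_ _≟ᵃ_

  _∈ᶜ?_ : ∀ p C → Dec (p ∈ cyclicPairs C)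
  p ∈ᶜ? C = p ∈ᵃ? cyclicPairs C

  packingFlow : Packing → Fin n → Fin n → Carrier
  packingFlow = flowOf F I

  Cycles : Packing → Set c
  Cycles P = All (λ Cw → IsCycle Arc (proj₁ Cw)) P

  packingFlow-++ : ∀ P Q v u → packingFlow (P ++ Q) v u ≈ packingFlow P v u + packingFlow Q v u
  packingFlow-++ []      Q v u = ≈-sym (+-identityˡ _)
  packingFlow-++ (_ ∷ P) Q v u = ≈-trans (+-congˡ (packingFlow-++ P Q v u)) (≈-sym (+-assoc _ _ _))

  packingFlow-nonneg : ∀ {P} → All (λ Cw → 0# < proj₂ Cw) P → ∀ v u → 0# ≤ packingFlow P v u
  packingFlow-nonneg {[]}          []          v u = ≤-refl
  packingFlow-nonneg {(C , w) ∷ P} (0<w ∷ 0<P) v u =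
    +-nonneg (indicator-nonneg (does ((v , u) ∈ᶜ? C))) (packingFlow-nonneg 0<P v u)
    where
    indicator-nonneg : ∀ b → 0# ≤ (if b then w else 0#)
    indicator-nonneg true  = <⇒≤ 0<w
    indicator-nonneg false = ≤-refl

  indicator≈load : ∀ {C} → Unique C → ∀ w v u →
                   (if does ((v , u) ∈ᶜ? C) then w else 0#) ≈ load w (cyclicPairs C) (v , u)
  indicator≈load u w v u′ = ≈-sym (load-unique w (Unique-cyclicPairs u) (v , u′))

  packingFlow-uniform : ∀ e {Cs} → All (IsCycle Arc) Cs → ∀ v u →
                        packingFlow (map (_, e) Cs) v u ≈ load e (concatMap cyclicPairs Cs) (v , u)
  packingFlow-uniform e {[]}     []               v u = ≈-refl
  packingFlow-uniform e {C ∷ Cs} ((_ , u , _) ∷ cs) v u′ =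
    ≈-trans (+-cong (indicator≈load u e v u′) (packingFlow-uniform e cs v u′))
            (≈-sym (load-++ e (cyclicPairs C) (concatMap cyclicPairs Cs) (v , u′)))

  packingFlow-¬Arc : ∀ {P} → Cycles P → ∀ {v u} → ¬ Arc v u → packingFlow P v u ≈ 0#
  packingFlow-¬Arc {[]}          []                    ¬arc = ≈-refl
  packingFlow-¬Arc {(C , w) ∷ P} ((_ , _ , arcs) ∷ cs) {v} {u} ¬arc with (v , u) ∈ᶜ? C
  ... | yes vu∈ = ⊥-elim (¬arc (All.lookup arcs vu∈))
  ... | no _    = ≈-trans (+-identityˡ _) (packingFlow-¬Arc cs ¬arc)

  packingFlow-pos⇒Arc : ∀ {P} → Cycles P → ∀ {v u} → 0# < packingFlow P v u → Arc v u
  packingFlow-pos⇒Arc cs {v} {u} 0<f with arc v u Bool.≟ true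
  ... | yes a  = a
  ... | no ¬a  = ⊥-elim (<-irrefl (≈-sym (packingFlow-¬Arc cs ¬a)) 0<f)

  firstCycle : List (List (Fin n)) → Fin n × Fin n → List (Fin n)
  firstCycle []       p = []
  firstCycle (C ∷ Cs) p = if does (p ∈ᶜ? C) then C else firstCycle Cs p

  firstCycle-spec : ∀ {P} → Cycles P → ∀ {v u} → 0# < packingFlow P v u →
    IsCycle Arc (firstCycle (map proj₁ P) (v , u)) × (v , u) ∈ cyclicPairs (firstCycle (map proj₁ P) (v , u))
  firstCycle-spec {[]}          []        0<0 = ⊥-elim (<-irrefl ≈-refl 0<0)
  firstCycle-spec {(C , w) ∷ P} (cy ∷ cs) {v} {u} 0<f with (v , u) ∈ᶜ? C
  ... | yes vu∈ = cy , vu∈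
  ... | no _    = firstCycle-spec cs (<-respʳ-≈ (+-identityˡ _) 0<f)

  sum-load-out : ∀ e L w → ∑[ y < n ] load e L (w , y) ≈ Vertex.load e (map proj₁ L) w
  sum-load-out e []            w = sum-zero {n} _ (λ _ → ≈-refl)
  sum-load-out e ((a , b) ∷ L) w =
    ≈-trans (∑-distrib-+ (λ y → δ e (w , y) (a , b)) (λ y → load e L (w , y)))
            (+-cong (sum-δ (w Fin.≟ a)) (sum-load-out e L w))
    where
    sum-δ : Dec (w ≡ a) → ∑[ y < n ] δ e (w , y) (a , b) ≈ Vertex.δ e w a
    sum-δ (yes refl) = ≈-trans (sum-point _ b (λ y y≢b → δ-≢ e {w , y} (λ eq → y≢b (cong proj₂ eq))))
                               (≈-trans (δ-≡ e (w , b)) (≈-sym (Vertex.δ-≡ e w)))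
    sum-δ (no w≢a)   = ≈-trans (sum-zero _ (λ y → δ-≢ e {w , y} (λ eq → w≢a (cong proj₁ eq))))
                               (≈-sym (Vertex.δ-≢ e w≢a))

  sum-load-in : ∀ e L w → ∑[ y < n ] load e L (y , w) ≈ Vertex.load e (map proj₂ L) w
  sum-load-in e []            w = sum-zero {n} _ (λ _ → ≈-refl)
  sum-load-in e ((a , b) ∷ L) w =
    ≈-trans (∑-distrib-+ (λ y → δ e (y , w) (a , b)) (λ y → load e L (y , w)))
            (+-cong (sum-δ (w Fin.≟ b)) (sum-load-in e L w))
    where
    sum-δ : Dec (w ≡ b) → ∑[ y < n ] δ e (y , w) (a , b) ≈ Vertex.δ e w b
    sum-δ (yes refl) = ≈-trans (sum-point _ a (λ y y≢a → δ-≢ e {y , w} (λ eq → y≢a (cong proj₁ eq))))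
                               (≈-trans (δ-≡ e (a , w)) (≈-sym (Vertex.δ-≡ e w)))
    sum-δ (no w≢b)   = ≈-trans (sum-zero _ (λ y → δ-≢ e {y , w} (λ eq → w≢b (cong proj₂ eq))))
                               (≈-sym (Vertex.δ-≢ e w≢b))

  -- the tails of the arcs of a cycle are its vertices, their heads a rotation of them
  conservation : ∀ {P} → Cycles P → ∀ w → ∑[ y < n ] packingFlow P w y ≈ ∑[ y < n ] packingFlow P y w
  conservation {[]}          []                 w = ≈-refl
  conservation {(C , e) ∷ P} ((_ , u , _) ∷ cs) w = begin
    ∑[ y < n ] packingFlow ((C , e) ∷ P) w y                 ≈⟨ ∑-distrib-+ (λ y → I[ w , y ]) (packingFlow P w) ⟩
    ∑[ y < n ] I[ w , y ] + ∑[ y < n ] packingFlow P w y     ≈⟨ +-cong (sum-cong-≋ (λ y → indicator≈load u e w y))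
                                                                       (conservation cs w) ⟩
    ∑[ y < n ] load e C′ (w , y) + rest                      ≈⟨ +-congʳ (sum-load-out e C′ w) ⟩
    Vertex.load e (map proj₁ C′) w + rest                    ≡⟨ cong (λ L → Vertex.load e L w + rest)
                                                                     (map-proj₁-cyclicPairs C) ⟩
    Vertex.load e C w + rest                                 ≈⟨ +-congʳ (Vertex.load-↭ e (rotate-↭ C) w) ⟨
    Vertex.load e (rotate C) w + rest                        ≡⟨ cong (λ L → Vertex.load e L w + rest)
                                                                     (map-proj₂-cyclicPairs C) ⟨
    Vertex.load e (map proj₂ C′) w + rest                    ≈⟨ +-congʳ (sum-load-in e C′ w) ⟨
    ∑[ y < n ] load e C′ (y , w) + rest                      ≈⟨ +-congʳ (sum-cong-≋ (λ y → indicator≈load u e y w)) ⟨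
    ∑[ y < n ] I[ y , w ] + rest                             ≈⟨ ∑-distrib-+ (λ y → I[ y , w ]) (λ y → packingFlow P y w) ⟨
    ∑[ y < n ] packingFlow ((C , e) ∷ P) y w                 ∎
    where
    open SetoidReasoning setoid
    C′ = cyclicPairs C
    rest = ∑[ y < n ] packingFlow P y w
    I[_] : Fin n × Fin n → Carrier
    I[ p ] = if does (p ∈ᶜ? C) then e else 0#

module Domination {c ℓ} (F : OrderedField c ℓ) {n} (I : PX F n) where

  open OrderedFieldProperties F
  open PX I
  open Flows F I
  open Exchange

  Agree : (Fin n → Fin n → Carrier) → (Fin n → Fin n → Carrier) → Fin n → Fin n → Set ℓ
  Agree f g v u = f v u ≈ g v u

  LexGt⇒First : ∀ {f g v} xs → LexGt F I f g v xs → First (Agree f g v) (λ u → g v u < f v u) xs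
  LexGt⇒First (u ∷ us) (inj₁ g<f)       = First.[ g<f ]
  LexGt⇒First (u ∷ us) (inj₂ (f≈g , l)) = f≈g ∷ LexGt⇒First us l

  First⇒LexGt : ∀ {f g v xs} → First (Agree f g v) (λ u → g v u < f v u) xs → LexGt F I f g v xs
  First⇒LexGt First.[ g<f ]      = inj₁ g<f
  First⇒LexGt (f≈g ∷ rest) = inj₂ (f≈g , First⇒LexGt rest)

  LexGt-asym : ∀ {f g v} xs → LexGt F I f g v xs → ¬ LexGt F I g f v xs
  LexGt-asym (u ∷ us) (inj₁ g<f)       (inj₁ f<g)       = <-asym g<f f<g
  LexGt-asym (u ∷ us) (inj₁ g<f)       (inj₂ (g≈f , _)) = <-irrefl g≈f g<f
  LexGt-asym (u ∷ us) (inj₂ (f≈g , _)) (inj₁ f<g)       = <-irrefl f≈g f<g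
  LexGt-asym (u ∷ us) (inj₂ (_ , l))   (inj₂ (_ , l′))  = LexGt-asym us l l′

  All-Agree⇒¬LexGt : ∀ {f g v xs} → All (Agree f g v) xs → ¬ LexGt F I f g v xs
  All-Agree⇒¬LexGt agree l = First.All⇒¬First (λ f≈g g<f → <-irrefl (≈-sym f≈g) g<f) agree (LexGt⇒First _ l)

  record Perturbation (X : Exchange F I) : Set (c ⊔ ℓ) where
    field
      packing′       : Packing
      cycles′        : Cycles packing′
      positive′      : All (λ Cw → 0# < proj₂ Cw) packing′
      step           : Carrier
      step-pos       : 0# < step
      removed        : List (Fin n × Fin n)
      added          : List (Fin n × Fin n)
      balance        : ∀ v u → packingFlow packing′ v u + load step removed (v , u)
                                 ≈ flow X v u + load step added (v , u)
      added-arcs     : All (uncurry Arc) added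
      added-fits     : All (λ p → flow X (proj₁ p) (proj₂ p) + length added · step ≤ cap (proj₁ p) (proj₂ p)) added
      compensated    : ∀ {v u} → (v , u) ∈ removed → ∃ λ t → Prefers v t u × (v , t) ∈ added
      added-nonempty : ∃ λ p → p ∈ added

  module _ {X : Exchange F I} (P : Perturbation X) where

    open Perturbation P

    perturbed : Exchange F I
    perturbed = record
      { packing = packing′ ; cycles = cycles′ ; positive = positive′ ; feasible = feasible′ }
      where
      flow′≤ : ∀ v u → packingFlow packing′ v u ≤ flow X v u + load step added (v , u)
      flow′≤ v u = ≤-trans (x≤x+y (load-nonneg (<⇒≤ step-pos) removed (v , u))) (inj₂ (balance v u))
      feasible′ : ∀ v u → packingFlow packing′ v u ≤ cap v u
      feasible′ v u with (v , u) ∈ᵃ? added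
      ... | yes vu∈ = ≤-trans (flow′≤ v u)
                        (≤-trans (+-monoʳ-≤ _ (load-≤ (<⇒≤ step-pos) added (v , u))) (All.lookup added-fits vu∈))
      ... | no vu∉  = ≤-trans (flow′≤ v u)
                        (≤-respˡ-≈ (≈-sym (≈-trans (+-congˡ (load-∉ step vu∉)) (+-identityʳ _))) (feasible X v u))

    private
      Y = perturbed

      Touched : Fin n → Fin n → Set
      Touched v u = (v , u) ∈ removed ⊎ (v , u) ∈ added

      touched? : ∀ v u → Dec (Touched v u)
      touched? v u = ((v , u) ∈ᵃ? removed) ⊎-dec ((v , u) ∈ᵃ? added)

      untouched-agree : ∀ {v u} → ¬ Touched v u → flow Y v u ≈ flow X v u
      untouched-agree {v} {u} ¬t = begin
        flow Y v u                             ≈⟨ +-identityʳ _ ⟨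
        flow Y v u + 0#                        ≈⟨ +-congˡ (load-∉ step (λ r → ¬t (inj₁ r))) ⟨
        flow Y v u + load step removed (v , u) ≈⟨ balance v u ⟩
        flow X v u + load step added (v , u)   ≈⟨ +-congˡ (load-∉ step (λ a → ¬t (inj₂ a))) ⟩
        flow X v u + 0#                        ≈⟨ +-identityʳ _ ⟩
        flow X v u                             ∎
        where open SetoidReasoning setoid

      added-gains : ∀ {v u} → (v , u) ∉ removed → (v , u) ∈ added → flow X v u < flow Y v u
      added-gains {v} {u} r∉ a∈ = <-respʳ-≈ eq (x<x+y (load-pos step-pos a∈))
        where
        eq : flow X v u + load step added (v , u) ≈ flow Y v u
        eq = ≈-trans (≈-sym (balance v u)) (≈-trans (+-congˡ (load-∉ step r∉)) (+-identityʳ _))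

      touched⊎ : ∀ v u → ¬ Touched v u ⊎ Touched v u
      touched⊎ v u = Sum.swap (toSum (touched? v u))

      -- A removed arc at the first touched position would be compensated by an
      -- earlier, hence untouched, added arc; so the first touched arc gains.
      first-touched-gains : ∀ {v} → First (λ u → ¬ Touched v u) (Touched v) (pref v) → Better F I Y X v
      first-touched-gains {v} first = First⇒LexGt (from-view (First.toView first) refl)
        where
        from-view : ∀ {L} → First.FirstView (λ u → ¬ Touched v u) (Touched v) L → L ≡ pref v →
                    First (Agree (flow Y) (flow X) v) (λ u → flow X v u < flow Y v u) L
        from-view (First._++_∷_ {as} {u} untouched touched _) L≡ =
          First.++⁺ (All.map untouched-agree untouched) First.[ gain touched ]
          where
          not-removed : (v , u) ∉ removed
          not-removed r∈ with compensated r∈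
          ... | t , (xs , ys , pref≡ , u∈ys) , t∈ =
            All.lookup untouched (∈-before as xs (subst Unique (sym L≡) (pref-uniq v)) (trans L≡ pref≡) u∈ys)
                       (inj₂ t∈)
          gain : Touched v u → flow X v u < flow Y v u
          gain (inj₁ r∈) = ⊥-elim (not-removed r∈)
          gain (inj₂ a∈) = added-gains not-removed a∈

    perturbed-dominates : Dominates F I perturbed X
    perturbed-dominates = no-loser , winner
      where
      no-loser : ∀ v → ¬ Better F I X Y v
      no-loser v with First.first (touched⊎ v) (pref v)
      ... | inj₁ first     = LexGt-asym (pref v) (first-touched-gains first)
      ... | inj₂ untouched = All-Agree⇒¬LexGt (All.map (λ ¬t → ≈-sym (untouched-agree ¬t)) untouched)
      winner : ∃ (Better F I Y X)
      winner with added-nonempty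
      ... | (a , b) , ab∈ with First.first (touched⊎ a) (pref a)
      ...   | inj₁ first     = a , first-touched-gains first
      ...   | inj₂ untouched =
        ⊥-elim (All.lookup untouched (Equivalence.from (pref-arcs a b) (All.lookup added-arcs ab∈)) (inj₂ ab∈))

  perturbation⇒¬ParetoOptimal : ∀ {X} → Perturbation X → ¬ ParetoOptimal F I X
  perturbation⇒¬ParetoOptimal P optimal = optimal (perturbed P , perturbed-dominates P)

module Reduction {c ℓ} (F : OrderedField c ℓ) {n} (I : PX F n) where

  open OrderedFieldProperties F
  open PX I
  open Flows F I

  reduceAt : Carrier → Fin n × Fin n → Packing → Packing
  reduceAt e p []            = []
  reduceAt e p ((C , w) ∷ P) = if does (p ∈ᶜ? C) then (C , w + - e) ∷ P else (C , w) ∷ reduceAt e p P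

  reduce : Carrier → List (Fin n × Fin n) → Packing → Packing
  reduce e []       P = P
  reduce e (p ∷ ps) P = reduceAt e p (reduce e ps P)

  reduceAt-cycles : ∀ e p {P} → map proj₁ (reduceAt e p P) ≡ map proj₁ P
  reduceAt-cycles e p {[]}          = refl
  reduceAt-cycles e p {(C , w) ∷ P} with p ∈ᶜ? C
  ... | yes _ = refl
  ... | no _  = cong (C ∷_) (reduceAt-cycles e p)

  reduce-cycles : ∀ e ps {P} → map proj₁ (reduce e ps P) ≡ map proj₁ P
  reduce-cycles e []       = refl
  reduce-cycles e (p ∷ ps) = trans (reduceAt-cycles e p) (reduce-cycles e ps)

  reduce-Cycles : ∀ e ps {P} → Cycles P → Cycles (reduce e ps P)
  reduce-Cycles e ps {P} cs =
    All.map⁻ (subst (All (IsCycle Arc)) (sym (reduce-cycles e ps)) (All.map⁺ cs))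

  reduceAt-weights : ∀ {e} → 0# < e → ∀ p k {P} → All (λ Cw → suc k · e < proj₂ Cw) P →
                     All (λ Cw → k · e < proj₂ Cw) (reduceAt e p P)
  reduceAt-weights 0<e p k {[]}          []         = []
  reduceAt-weights 0<e p k {(C , w) ∷ P} (lt ∷ lts) with p ∈ᶜ? C
  ... | yes _ = x+y<z⇒y<z-x lt ∷ All.map (<-trans (·-<-suc k 0<e)) lts
  ... | no _  = <-trans (·-<-suc k 0<e) lt ∷ reduceAt-weights 0<e p k lts

  reduce-weights : ∀ {e} → 0# < e → ∀ ps k {P} → All (λ Cw → (length ps ℕ.+ k) · e < proj₂ Cw) P →
                   All (λ Cw → k · e < proj₂ Cw) (reduce e ps P)
  reduce-weights 0<e []       k lts = lts
  reduce-weights {e} 0<e (p ∷ ps) k {P} lts = reduceAt-weights 0<e p k (reduce-weights 0<e ps (suc k) lts′)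
    where
    lts′ : All (λ Cw → (length ps ℕ.+ suc k) · e < proj₂ Cw) P
    lts′ = subst (λ m → All (λ Cw → m · e < proj₂ Cw) P) (sym (ℕ.+-suc (length ps) k)) lts

  reduceAt-flow : ∀ e p {P} → Cycles P → ∀ v u →
    packingFlow (reduceAt e p P) v u + load e (cyclicPairs (firstCycle (map proj₁ P) p)) (v , u) ≈ packingFlow P v u
  reduceAt-flow e p {[]}          []                 v u = +-identityʳ 0#
  reduceAt-flow e p {(C , w) ∷ P} ((_ , uC , _) ∷ cs) v u with p ∈ᶜ? C
  ... | yes _ = begin
    (I[ w + - e ] + packingFlow P v u) + load e (cyclicPairs C) (v , u) ≈⟨ +-congˡ (indicator≈load uC e v u) ⟨
    (I[ w + - e ] + packingFlow P v u) + I[ e ]                         ≈⟨ +-assoc _ _ _ ⟩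
    I[ w + - e ] + (packingFlow P v u + I[ e ])                         ≈⟨ +-congˡ (+-comm _ _) ⟩
    I[ w + - e ] + (I[ e ] + packingFlow P v u)                         ≈⟨ +-assoc _ _ _ ⟨
    (I[ w + - e ] + I[ e ]) + packingFlow P v u                         ≈⟨ +-congʳ (recombine (does ((v , u) ∈ᶜ? C))) ⟩
    I[ w ] + packingFlow P v u                                          ∎
    where
    open SetoidReasoning setoid
    I[_] : Carrier → Carrier
    I[ x ] = if does ((v , u) ∈ᶜ? C) then x else 0#
    recombine : ∀ b → (if b then w + - e else 0#) + (if b then e else 0#) ≈ (if b then w else 0#)
    recombine true  = x-y+y≈x w e
    recombine false = +-identityʳ 0#
  ... | no _ = ≈-trans (+-assoc _ _ _) (+-congˡ (reduceAt-flow e p cs v u))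

  reduce-flow : ∀ e ps {P} → Cycles P → ∀ v u →
    packingFlow (reduce e ps P) v u + load e (concatMap (λ p → cyclicPairs (firstCycle (map proj₁ P) p)) ps) (v , u)
      ≈ packingFlow P v u
  reduce-flow e []       cs v u = +-identityʳ _
  reduce-flow e (p ∷ ps) {P} cs v u = begin
    packingFlow (reduceAt e p R) v u + load e (C p ++ concatMap C ps) (v , u)
      ≈⟨ +-congˡ (load-++ e (C p) (concatMap C ps) (v , u)) ⟩
    packingFlow (reduceAt e p R) v u + (load e (C p) (v , u) + load e (concatMap C ps) (v , u))
      ≈⟨ +-assoc _ _ _ ⟨
    (packingFlow (reduceAt e p R) v u + load e (C p) (v , u)) + load e (concatMap C ps) (v , u)
      ≡⟨ cong (λ Cs → (packingFlow (reduceAt e p R) v u + load e (cyclicPairs (firstCycle Cs p)) (v , u))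
                      + load e (concatMap C ps) (v , u))
              (reduce-cycles e ps) ⟨
    (packingFlow (reduceAt e p R) v u + load e (cyclicPairs (firstCycle (map proj₁ R) p)) (v , u)) + load e (concatMap C ps) (v , u)
      ≈⟨ +-congʳ (reduceAt-flow e p (reduce-Cycles e ps cs) v u) ⟩
    packingFlow R v u + load e (concatMap C ps) (v , u)
      ≈⟨ reduce-flow e ps cs v u ⟩
    packingFlow P v u ∎
    where
    open SetoidReasoning setoid
    R = reduce e ps P
    C = λ p → cyclicPairs (firstCycle (map proj₁ P) p)

module Necessity {c ℓ} (F : OrderedField c ℓ) {n} (I : PX F n) (X : Exchange F I) where

  open OrderedFieldProperties F
  open PX I
  open Exchange
  open Flows F I
  open Domination F I
  open Reduction F I

  Res : Fin n → Fin n → Set ℓ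
  Res = Residual F I X

  ∃-step : ∀ K (A : List (Fin n × Fin n)) → All (uncurry Res) A → ∃ λ e → 0# < e ×
    All (λ p → flow X (proj₁ p) (proj₂ p) + K · e < cap (proj₁ p) (proj₂ p)) A ×
    All (λ Cw → K · e < proj₂ Cw) (packing X)
  ∃-step K A res with ∃-uniform-step K (map gap A ++ map (λ Cw → 0# , proj₂ Cw) (packing X))
                                     (All.++⁺ (All.map⁺ (All.map proj₂ res)) (All.map⁺ (positive X)))
    where gap = λ (p : Fin n × Fin n) → flow X (proj₁ p) (proj₂ p) , cap (proj₁ p) (proj₂ p)
  ... | e , 0<e , fit =
    e , 0<e , All.map⁻ (All.++⁻ˡ _ fit) , All.map (<-respˡ-≈ (+-identityˡ _)) (All.map⁻ (All.++⁻ʳ _ fit))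

  fits-within : ∀ {K e} {A : List (Fin n × Fin n)} → length A ℕ.≤ K → 0# ≤ e →
    All (λ p → flow X (proj₁ p) (proj₂ p) + K · e < cap (proj₁ p) (proj₂ p)) A →
    All (λ p → flow X (proj₁ p) (proj₂ p) + length A · e ≤ cap (proj₁ p) (proj₂ p)) A
  fits-within A≤K 0≤e = All.map (λ fit → <⇒≤ (≤-<-trans (+-monoʳ-≤ _ (·-monoˡ-≤ A≤K 0≤e)) fit))

  cycle-perturbation : ∀ {C} → IsCycle Res C → Perturbation X
  cycle-perturbation {[]}     (C≢[] , _) = ⊥-elim (C≢[] refl)
  cycle-perturbation {c ∷ cs} (C≢[] , uC , res) with ∃-step (length (cyclicPairs (c ∷ cs))) (cyclicPairs (c ∷ cs)) res
  ... | e , 0<e , fit , _ = record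
    { packing′       = (c ∷ cs , e) ∷ packing X
    ; cycles′        = (C≢[] , uC , All.map proj₁ res) ∷ cycles X
    ; positive′      = 0<e ∷ positive X
    ; step           = e
    ; step-pos       = 0<e
    ; removed        = []
    ; added          = cyclicPairs (c ∷ cs)
    ; balance        = λ v u → ≈-trans (+-identityʳ _) (≈-trans (+-congʳ (indicator≈load uC e v u)) (+-comm _ _))
    ; added-arcs     = All.map proj₁ res
    ; added-fits     = fits-within ℕ.≤-refl (<⇒≤ 0<e) fit
    ; compensated    = λ ()
    ; added-nonempty = cyclicPairs-nonempty c cs
    }

  ParetoOptimal⇒Maximal : ParetoOptimal F I X → Maximal F I X
  ParetoOptimal⇒Maximal optimal (C , cycle) = perturbation⇒¬ParetoOptimal (cycle-perturbation cycle) optimal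

  Member : Set
  Member = Fin n × Fin n × Fin n

  agent partner wanted : Member → Fin n
  agent   = proj₁
  partner = λ m → proj₁ (proj₂ m)
  wanted  = λ m → proj₂ (proj₂ m)

  Supported : Member → Set ℓ
  Supported m = InSupport F I X (agent m) (partner m)

  usedCycle : Member → List (Fin n)
  usedCycle m = firstCycle (map proj₁ (packing X)) (agent m , partner m)

  record Hop (mm′ : Member × Member) : Set ℓ where
    m  = proj₁ mm′
    m′ = proj₂ mm′
    field
      back      : Star Arc (partner m) (agent m)
      back-↭    : (agent m , partner m) ∷ arcs back ↭ cyclicPairs (usedCycle m)
      trade     : Res (agent m) (wanted m)
      onward    : Star Res (wanted m) (partner m′)

  hopWalk : ∀ {mm′} → Hop mm′ → Star Arc (partner (proj₁ mm′)) (partner (proj₂ mm′))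
  hopWalk h = Hop.back h ◅◅ proj₁ (Hop.trade h) ◅ Star.map proj₁ (Hop.onward h)

  newArcs : ∀ {mm′} → Hop mm′ → List (Fin n × Fin n)
  newArcs {m , _} h = (agent m , wanted m) ∷ arcs (Hop.onward h)

  hopWalk-arcs : ∀ {mm′} (h : Hop mm′) → arcs (hopWalk h) ≡ arcs (Hop.back h) ++ newArcs h
  hopWalk-arcs h = trans (arcs-◅◅ (Hop.back h) _) (cong (λ l → arcs (Hop.back h) ++ _ ∷ l) (arcs-map proj₁ (Hop.onward h)))

  hop : ∀ {m m′} → Supported m → PathVia Res (agent m) (wanted m) (partner m′) → Hop (m , m′)
  hop support path with firstCycle-spec (cycles X) support | PathVia⇒Star path
  ... | cycle , ∈cycle | trade , onward with cycle-segment cycle ∈cycle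
  ...   | back , back-↭ = record { back = back ; back-↭ = back-↭ ; trade = trade ; onward = onward }

  module _ (m₀ : Member) (ms : List Member) (hops : All Hop (cyclicPairs (m₀ ∷ ms))) where

    private
      L = cyclicPairs (m₀ ∷ ms)

    removed : List (Fin n × Fin n)
    removed = map (λ mm′ → agent (proj₁ mm′) , partner (proj₁ mm′)) L

    added : List (Fin n × Fin n)
    added = concatAll newArcs hops

    usedArcs : List (Fin n × Fin n)
    usedArcs = concatMap (λ p → cyclicPairs (firstCycle (map proj₁ (packing X)) p)) removed

    backArcs : List (Fin n × Fin n)
    backArcs = concatAll (λ h → arcs (Hop.back h)) hops

    private
      loop = closedChain partner hopWalk m₀ ms hops
      decomposition = closedWalk⇒cycles (proj₁ loop)

    newCycles : List (List (Fin n))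
    newCycles = proj₁ decomposition

    newCycles-ok : All (IsCycle Arc) newCycles
    newCycles-ok = proj₁ (proj₂ decomposition)

    loop-↭ : concatMap cyclicPairs newCycles ↭ backArcs ++ added
    loop-↭ = begin
      concatMap cyclicPairs newCycles                        ↭⟨ proj₂ (proj₂ decomposition) ⟩
      arcs (proj₁ loop)                                      ≡⟨ proj₂ loop ⟩
      concatAll (λ h → arcs (hopWalk h)) hops                ↭⟨ concatAll-↭ (λ h → ↭-reflexive (hopWalk-arcs h)) hops ⟩
      concatAll (λ h → arcs (Hop.back h) ++ newArcs h) hops  ↭⟨ concatAll-++ _ newArcs hops ⟨
      backArcs ++ added                                      ∎
      where open PermutationReasoning

    removed-↭ : removed ++ backArcs ↭ usedArcs
    removed-↭ = begin
      removed ++ backArcs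
        ≡⟨ cong (_++ backArcs)
                (trans (sym (concatMap-pure removed)) (trans (concatMap-map [_] _ L) (sym (concatAll-const _ hops)))) ⟩
      concatAll (λ {mm′} _ → [ agent (proj₁ mm′) , partner (proj₁ mm′) ]) hops ++ backArcs
        ↭⟨ concatAll-++ _ _ hops ⟩
      concatAll (λ h → _ ∷ arcs (Hop.back h)) hops
        ↭⟨ concatAll-↭ Hop.back-↭ hops ⟩
      concatAll (λ {mm′} _ → cyclicPairs (usedCycle (proj₁ mm′))) hops
        ≡⟨ trans (concatAll-const _ hops) (sym (concatMap-map _ _ L)) ⟩
      usedArcs ∎
      where open PermutationReasoning

    arcs-balance : concatMap cyclicPairs newCycles ++ removed ↭ added ++ usedArcs
    arcs-balance = begin
      concatMap cyclicPairs newCycles ++ removed ↭⟨ ++⁺ʳ removed loop-↭ ⟩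
      (backArcs ++ added) ++ removed           ↭⟨ ++⁺ʳ removed (++-comm backArcs added) ⟩
      (added ++ backArcs) ++ removed           ≡⟨ ++-assoc added backArcs removed ⟩
      added ++ backArcs ++ removed             ↭⟨ ++⁺ˡ added (++-comm backArcs removed) ⟩
      added ++ removed ++ backArcs             ↭⟨ ++⁺ˡ added removed-↭ ⟩
      added ++ usedArcs                        ∎
      where open PermutationReasoning

    added-residual : All (uncurry Res) added
    added-residual = concatAll-All newArcs (λ h → Hop.trade h ∷ arcs-All (Hop.onward h)) hops

    rerouted : Carrier → Packing
    rerouted e = reduce e removed (packing X) ++ map (_, e) newCycles

    rerouted-balance : ∀ e v u → packingFlow (rerouted e) v u + load e removed (v , u) ≈ flow X v u + load e added (v , u)
    rerouted-balance e v u = begin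
      packingFlow (R ++ map (_, e) newCycles) v u + load e removed (v , u)
        ≈⟨ +-congʳ (≈-trans (packingFlow-++ R _ v u) (+-congˡ (packingFlow-uniform e newCycles-ok v u))) ⟩
      (packingFlow R v u + load e new (v , u)) + load e removed (v , u)
        ≈⟨ ≈-trans (+-assoc _ _ _) (+-congˡ (≈-sym (load-++ e new removed (v , u)))) ⟩
      packingFlow R v u + load e (new ++ removed) (v , u)
        ≈⟨ +-congˡ (≈-trans (load-↭ e arcs-balance (v , u)) (load-++ e added usedArcs (v , u))) ⟩
      packingFlow R v u + (load e added (v , u) + load e usedArcs (v , u))
        ≈⟨ ≈-trans (+-congˡ (+-comm _ _)) (≈-sym (+-assoc _ _ _)) ⟩
      (packingFlow R v u + load e usedArcs (v , u)) + load e added (v , u)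
        ≈⟨ +-congʳ (reduce-flow e removed (cycles X) v u) ⟩
      flow X v u + load e added (v , u) ∎
      where
      open SetoidReasoning setoid
      R = reduce e removed (packing X)
      new = concatMap cyclicPairs newCycles

    added-nonempty : ∃ λ p → p ∈ added
    added-nonempty with cyclicPairs-nonempty m₀ ms
    ... | mm′ , mm′∈ = _ , ∈-concatAll newArcs hops mm′∈ (here refl)

    module _ (prefers : All (λ m → Prefers (agent m) (wanted m) (partner m)) (m₀ ∷ ms)) where

      compensated : ∀ {v u} → (v , u) ∈ removed → ∃ λ t → Prefers v t u × (v , t) ∈ added
      compensated vu∈ with ∈-map⁻ _ vu∈
      ... | mm′ , mm′∈ , refl =
        wanted (proj₁ mm′) , All.lookup (All-cyclicPairs⁺ prefers) mm′∈ , ∈-concatAll newArcs hops mm′∈ (here refl)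

      coalition-perturbation : Perturbation X
      coalition-perturbation with ∃-step (length removed ℕ.+ length added) added added-residual
      ... | e , 0<e , fit , heavy = record
        { packing′       = rerouted e
        ; cycles′        = All.++⁺ (reduce-Cycles e removed (cycles X)) (All.map⁺ newCycles-ok)
        ; positive′      = All.++⁺ (reduce-weights 0<e removed 0 (All.map (≤-<-trans removed·e≤) heavy))
                                   (All.map⁺ (All.universal (λ _ → 0<e) newCycles))
        ; step           = e
        ; step-pos       = 0<e
        ; removed        = removed
        ; added          = added
        ; balance        = rerouted-balance e
        ; added-arcs     = All.map proj₁ added-residual
        ; added-fits     = fits-within (ℕ.m≤n+m (length added) (length removed)) (<⇒≤ 0<e) fit
        ; compensated    = compensated
        ; added-nonempty = added-nonempty
        }
        where
        removed·e≤ : (length removed ℕ.+ 0) · e ≤ (length removed ℕ.+ length added) · e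
        removed·e≤ = ·-monoˡ-≤ (ℕ.+-monoʳ-≤ (length removed) ℕ.z≤n) (<⇒≤ 0<e)

  ParetoOptimal⇒CoalitionFree : ParetoOptimal F I X → CoalitionFree F I X
  ParetoOptimal⇒CoalitionFree optimal []        T≢[] _        _     _     = T≢[] refl
  ParetoOptimal⇒CoalitionFree optimal (m₀ ∷ ms) _    supports paths prefs =
    perturbation⇒¬ParetoOptimal (coalition-perturbation m₀ ms hops prefs) optimal
    where hops = All.zipWith (uncurry hop) (All-cyclicPairs⁺ supports , paths)

  CoalitionFree⇒TradeInFree : CoalitionFree F I X → TradeInFree F I X
  CoalitionFree⇒TradeInFree free v u support t path prefers =
    free [ v , u , t ] (λ ()) (support ∷ []) (path ∷ []) (prefers ∷ [])

module Sufficiency {c ℓ} (F : OrderedField c ℓ) {n} (I : PX F n) (X : Exchange F I)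
                   (maximal : Maximal F I X) (free : CoalitionFree F I X)
                   (Y : Exchange F I) (Y-dominates : Dominates F I Y X) where

  open OrderedFieldProperties F
  open FiniteSums F
  open PX I
  open Exchange
  open Flows F I
  open Domination F I

  fX fY : Fin n → Fin n → Carrier
  fX = flow X
  fY = flow Y

  Gain Loss : Fin n → Fin n → Set ℓ
  Gain v u = fX v u < fY v u
  Loss v u = fY v u < fX v u

  Steady : Fin n → Set ℓ
  Steady v = All (Agree fX fY v) (pref v)

  Top : Fin n → Fin n → Set ℓ
  Top v t = First (Agree fX fY v) (λ u → u ≡ t × Gain v u) (pref v)

  private
    classify : ∀ {v us} → First (Agree fX fY v) (λ u → ¬ Agree fX fY v u) us →
               First (Agree fX fY v) (Gain v) us ⊎ First (Agree fX fY v) (Loss v) us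
    classify {v} {u ∷ _} First.[ differ ] with compare (fX v u) (fY v u)
    ... | tri< gain _    _    = inj₁ First.[ gain ]
    ... | tri≈ _    same _    = ⊥-elim (differ same)
    ... | tri> _    _    loss = inj₂ First.[ loss ]
    classify (same ∷ first) with classify first
    ... | inj₁ gains  = inj₁ (same ∷ gains)
    ... | inj₂ losses = inj₂ (same ∷ losses)

  steady-or-top : ∀ v → Steady v ⊎ ∃ (Top v)
  steady-or-top v with First.first (λ u → toSum (fX v u ≈? fY v u)) (pref v)
  ... | inj₂ steady = inj₁ steady
  ... | inj₁ first with classify first
  ...   | inj₁ gains  = inj₂ (First-pin gains)
  ...   | inj₂ losses = ⊥-elim (proj₁ Y-dominates v (First⇒LexGt losses))

  steady-agrees : ∀ {v} → Steady v → ∀ y → fX v y ≈ fY v y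
  steady-agrees {v} steady y with DecMembership._∈?_ Fin._≟_ y (pref v)
  ... | yes y∈ = All.lookup steady y∈
  ... | no  y∉ = ≈-trans (packingFlow-¬Arc (cycles X) ¬arc) (≈-sym (packingFlow-¬Arc (cycles Y) ¬arc))
    where
    ¬arc : ¬ Arc v y
    ¬arc arc = y∉ (Equivalence.from (pref-arcs v y) arc)

  Top⇒Gain : ∀ {v t} → Top v t → Gain v t
  Top⇒Gain top with First.satisfied top
  ... | _ , refl , gain = gain

  Top⇒Residual : ∀ {v t} → Top v t → Residual F I X v t
  Top⇒Residual {v} {t} top =
    Equivalence.to (pref-arcs v t) (First-pinned-∈ top) , <-≤-trans (Top⇒Gain top) (feasible Y v t)

  Top-unique : ∀ {v t t′} → Top v t → Top v t′ → t ≡ t′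
  Top-unique = First-pinned-unique (λ same gain → <-irrefl same gain)

  Top-acyclic : Acyclic Top
  Top-acyclic (C , C≢[] , u , tops) = maximal (C , C≢[] , u , All.map Top⇒Residual tops)

  loss⇒Top : ∀ {x w} → Loss x w → ∃ λ t → Top x t × Prefers x t w × InSupport F I X x w
  loss⇒Top {x} {w} loss with steady-or-top x
  ... | inj₁ steady    = ⊥-elim (<-irrefl (≈-sym (steady-agrees steady w)) loss)
  ... | inj₂ (t , top) =
    t , top , First-pinned-before {R = Loss x} (λ same → <-irrefl (≈-sym same)) <-asym top w∈ loss , 0<fX
    where
    0<fX : 0# < fX x w
    0<fX = ≤-<-trans (packingFlow-nonneg (positive Y) x w) loss
    w∈ : w ∈ pref x
    w∈ = Equivalence.from (pref-arcs x w) (packingFlow-pos⇒Arc (cycles X) 0<fX)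

  -- X and Y send the same flow out of a steady vertex, so by conservation also into it
  inflow-offset : ∀ {z w} → Steady w → Gain z w → ∃ λ x → Loss x w
  inflow-offset {z} {w} steady gain with Fin.any? (λ x → fY x w <? fX x w)
  ... | yes loss = loss
  ... | no  none = ⊥-elim (<-irrefl inflows≈ (sum-mono-< (λ x → ≮⇒≥ (λ loss → none (x , loss))) z gain))
    where
    open SetoidReasoning setoid
    inflows≈ : ∑[ x < n ] fX x w ≈ ∑[ x < n ] fY x w
    inflows≈ = begin
      ∑[ x < n ] fX x w ≈⟨ conservation (cycles X) w ⟨
      ∑[ y < n ] fX w y ≈⟨ sum-cong-≋ (steady-agrees steady) ⟩
      ∑[ y < n ] fY w y ≈⟨ conservation (cycles Y) w ⟩
      ∑[ x < n ] fY x w ∎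

  record State : Set ℓ where
    constructor state
    field
      agent  : Fin n
      target : Fin n
      top    : Top agent target

  open State

  record Step (s : State) : Set ℓ where
    field
      reached      : Fin n
      path         : PathVia (Residual F I X) (agent s) (target s) reached
      next         : State
      next-support : InSupport F I X (agent next) reached
      next-prefers : Prefers (agent next) (target next) reached

  step : ∀ s → Step s
  step (state x t top) with descend Top-acyclic steady-or-top top
  ... | z , w , path , top-zw , steady with inflow-offset steady (Top⇒Gain top-zw)
  ...   | x′ , loss with loss⇒Top loss
  ...     | t′ , top′ , prefers , support = record
    { reached = w ; path = PathVia-map Top⇒Residual path ; next = state x′ t′ top′
    ; next-support = support ; next-prefers = prefers }

  start : State
  start with proj₂ Y-dominates
  ... | u , better with First-pin (First.map₁ ≈-sym (LexGt⇒First (pref u) better))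
  ...   | t , top = state u t top

  states : ℕ → State
  states zero    = start
  states (suc k) = Step.next (step (states k))

  member : ℕ → Fin n × Fin n × Fin n
  member k = agent (states (suc k)) , Step.reached (step (states k)) , target (states (suc k))

  repeated-agent⇒⊥ : ∀ a d → agent (states a) ≡ agent (states (suc (d ℕ.+ a))) → ⊥
  repeated-agent⇒⊥ a d same-agent = free T (λ ()) supports paths prefers
    where
    g : ℕ → Fin n × Fin n × Fin n
    g k = member (k ℕ.+ a)
    T = applyUpTo g (suc d)
    b = suc (d ℕ.+ a)
    same-target : target (states a) ≡ target (states b)
    same-target = Top-unique (subst (λ v → Top v (target (states a))) same-agent (top (states a))) (top (states b))
    Link : Fin n × Fin n × Fin n → Fin n × Fin n × Fin n → Set ℓ
    Link m m′ = PathVia (Residual F I X) (proj₁ m) (proj₂ (proj₂ m)) (proj₁ (proj₂ m′))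
    wrap : Link (g d) (g 0)
    wrap = subst₂ (λ x t → PathVia (Residual F I X) x t (Step.reached (step (states a))))
                  same-agent same-target (Step.path (step (states a)))
    paths : All (λ p → Link (proj₁ p) (proj₂ p)) (cyclicPairs T)
    paths = All-cyclicPairs-applyUpTo {R = Link} g d (λ k → Step.path (step (states (suc (k ℕ.+ a))))) wrap
    supports : All (λ m → InSupport F I X (proj₁ m) (proj₁ (proj₂ m))) T
    supports = All.applyUpTo⁺₂ g (suc d) (λ k → Step.next-support (step (states (k ℕ.+ a))))
    prefers : All (λ m → Prefers (proj₁ m) (proj₂ (proj₂ m)) (proj₁ (proj₂ m))) T
    prefers = All.applyUpTo⁺₂ g (suc d) (λ k → Step.next-prefers (step (states (k ℕ.+ a))))

  absurd : ⊥
  absurd with Fin.pigeonhole (ℕ.n<1+n n) (λ i → agent (states (toℕ i)))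
  ... | i , j , i<j , same-agent with ℕ.m≤n⇒∃[o]m+o≡n i<j
  ...   | d , a+d≡b = repeated-agent⇒⊥ (toℕ i) d (trans same-agent (cong (λ k → agent (states k)) b≡))
    where
    b≡ : toℕ j ≡ suc (d ℕ.+ toℕ i)
    b≡ = trans (sym a+d≡b) (cong suc (ℕ.+-comm (toℕ i) d))

Maximal×CoalitionFree⇒ParetoOptimal : ∀ {c ℓ} (F : OrderedField c ℓ) {n} (I : PX F n) (X : Exchange F I) →
  Maximal F I X → CoalitionFree F I X → ParetoOptimal F I X
Maximal×CoalitionFree⇒ParetoOptimal F I X maximal free (Y , Y-dominates) =
  Sufficiency.absurd F I X maximal free Y Y-dominates

theorem2 : ∀ {c ℓ : Level} (F : OrderedField c ℓ) {n : ℕ} (I : PX F n) (X : Exchange F I) →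
    ParetoOptimal F I X ⇔ (Maximal F I X × TradeInFree F I X × CoalitionFree F I X)
theorem2 F I X = mk⇔
  (λ optimal → let free = ParetoOptimal⇒CoalitionFree optimal in
     ParetoOptimal⇒Maximal optimal , CoalitionFree⇒TradeInFree free , free)
  (λ (maximal , _ , free) → Maximal×CoalitionFree⇒ParetoOptimal F I X maximal free)
  where open Necessity F I X
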